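{- For $n\ge1$ let $T_n$ be the number of ordered bilabelled increasing trees with $n$ nodes (i.e. pairs consisting of an ordered tree with $n$ nodes and an increasing bilabelling of it with label set $\{1,\dots,2n\}$), and let $T(z)=\sum_{n\ge1}T_n\frac{z^{2n}}{(2n)!}$. Then \[T(z)=1-\exp\!\Big(-\big(\mathrm{erf}^{ -1}(\tfrac{\sqrt2}{\sqrt\pi}z)\big)^2\Big)=\sqrt{\pi}\int_0^{\frac{z\sqrt2}{\sqrt\pi}}\mathrm{erf}^{ -1}(x)\,dx.\] Moreover $T_n=\frac{(2n-2)!}{2^{n-1}}\,c_{n-1}$ for $n\ge1$, and the $T_n$ satisfy \[T_n=\sum_{k=1}^{n-1}\binom{2n-2}{2k}T_kT_{n-k}\quad (n\ge2),\qquad T_1=1.\]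
   Context: Ordered trees are rooted trees in which the children of each node form a linearly ordered sequence. An increasing bilabelling of a tree with $n$ nodes assigns to each node a set of exactly two integers from $\{1,\dots,2n\}$, these sets partitioning $\{1,\dots,2n\}$, such that every label of a child is larger than both labels of its parent. $\mathrm{erf}(z)=\frac{2}{\sqrt\pi}\int_0^z e^{ -x^2}dx$ is the error function and $\mathrm{erf}^{ -1}$ its inverse, whose expansion is $\mathrm{erf}^{ -1}(z)=\sum_{k\ge0}\frac{c_k}{2k+1}\big(\frac{\sqrt\pi}{2}z\big)^{2k+1}$ with $c_0=1$ and $c_k=\sum_{m=0}^{k-1}\frac{c_mc_{k-1-m}}{(m+1)(2m+1)}$ for $k>0$. -}

module Defs where

open import Data.Nat using (ℕ; zero; suc; _+_; _*_; _∸_; _^_; _<_; _≤_; NonZero)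
open import Data.Nat.Properties using (_!≢0; m^n≢0)
open import Data.Nat.Base using (_!)
open import Data.Integer using (+_)
open import Data.Rational using (ℚ; 0ℚ; 1ℚ) renaming (_+_ to _+ℚ_; _*_ to _*ℚ_; _/_ to _/ℚ_)
open import Data.List using (List; []; _∷_; _++_; map; foldr; upTo; length)
open import Data.List.Relation.Unary.All using (All)
open import Data.List.Relation.Unary.Unique.Propositional using (Unique)
open import Data.List.Membership.Propositional using (_∈_)
open import Data.List.Relation.Binary.Permutation.Propositional using (_↭_)
open import Data.Product using (Σ; _×_)
open import Data.Unit using (⊤)
open import Relation.Binary.PropositionalEquality using (_≡_)

-- Ordered bilabelled trees.
-- A node carries its label set {a, b}, stored canonically as a pair
-- with a < b (enforced in `Incr`), and an ordered list of children.

data BTree : Set where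
  node : (a b : ℕ) → List BTree → BTree

mutual
  size : BTree → ℕ
  size (node a b ts) = suc (sizes ts)

  sizes : List BTree → ℕ
  sizes []       = 0
  sizes (t ∷ ts) = size t + sizes ts

mutual
  labels : BTree → List ℕ
  labels (node a b ts) = a ∷ b ∷ labelsF ts

  labelsF : List BTree → List ℕ
  labelsF []       = []
  labelsF (t ∷ ts) = labels t ++ labelsF ts

mutual
  Incr : BTree → Set
  Incr (node a b ts) = a < b × IncrF a b ts

  IncrF : ℕ → ℕ → List BTree → Set
  IncrF a b []                   = ⊤
  IncrF a b (node a' b' us ∷ ts) =
    (a < a' × b < a' × a < b' × b < b') × Incr (node a' b' us) × IncrF a b ts

IsBIT : ℕ → BTree → Set
IsBIT n t = size t ≡ n × Incr t × labels t ↭ map suc (upTo (2 * n))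

CountIs : (BTree → Set) → ℕ → Set
CountIs P k = Σ (List BTree) λ L →
  Unique L × (∀ t → t ∈ L → P t) × (∀ t → P t → t ∈ L) × length L ≡ k

ℕtoℚ : ℕ → ℚ
ℕtoℚ n = + n /ℚ 1

invℕ : (n : ℕ) → .{{_ : NonZero n}} → ℚ
invℕ n = + 1 /ℚ n

invFact : ℕ → ℚ
invFact n = (+ 1 /ℚ (n !)) {{n !≢0}}

inv2^ : ℕ → ℚ
inv2^ n = (+ 1 /ℚ (2 ^ n)) {{m^n≢0 2 n}}

sumℚ : List ℚ → ℚ
sumℚ = foldr _+ℚ_ 0ℚ

nth : List ℚ → ℕ → ℚ
nth []       _       = 0ℚ
nth (x ∷ xs) zero    = x
nth (x ∷ xs) (suc i) = nth xs i

-- The coefficients c_k:  c_0 = 1,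
-- c_k = Σ_{m=0}^{k-1} c_m c_{k-1-m} / ((m+1)(2m+1))  for k > 0.
-- cs k = [c_0, …, c_{k-1}].

cNext : List ℚ → ℚ
cNext []          = 1ℚ
cNext l@(_ ∷ _)   = sumℚ (map (λ m → (nth l m *ℚ nth l (length l ∸ 1 ∸ m))
                                       *ℚ invℕ (suc m * suc (2 * m)))
                              (upTo (length l)))

cs : ℕ → List ℚ
cs zero    = []
cs (suc k) = cs k ++ (cNext (cs k) ∷ [])

c : ℕ → ℚ
c k = nth (cs (suc k)) k

Series : Set
Series = ℕ → ℚ

_⊛_ : Series → Series → Series
(F ⊛ G) n = sumℚ (map (λ i → F i *ℚ G (n ∸ i)) (upTo (suc n)))

oneS : Series
oneS zero    = 1ℚ
oneS (suc _) = 0ℚ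

powS : Series → ℕ → Series
powS F zero    = oneS
powS F (suc j) = F ⊛ powS F j

-- exp(F) = Σ_j F^j / j!, for F with zero constant term (then only
-- j ≤ n contributes to the coefficient of z^n).
expS : Series → Series
expS F n = sumℚ (map (λ j → powS F j n *ℚ invFact j) (upTo (suc n)))

integS : Series → Series
integS F zero    = 0ℚ
integS F (suc n) = F n *ℚ invℕ (suc n)

-- series Σ_k a_k z^{2k+1}  and  Σ_k a_k z^{2k}
oddS : (ℕ → ℚ) → Series
oddS a zero          = 0ℚ
oddS a (suc zero)    = a 0
oddS a (suc (suc n)) = oddS (λ k → a (suc k)) n

evenS : (ℕ → ℚ) → Series
evenS a zero          = a 0
evenS a (suc zero)    = 0ℚ
evenS a (suc (suc n)) = evenS (λ k → a (suc k)) n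

Tser : (ℕ → ℕ) → Series
Tser T = evenS coef
  where
  coef : ℕ → ℚ
  coef zero    = 0ℚ
  coef (suc k) = ℕtoℚ (T (suc k)) *ℚ invFact (2 * suc k)

-- V(z) = √2 · erf⁻¹(√2/√π · z) = Σ_k c_k/((2k+1) 2^k) z^{2k+1}
-- (from the given expansion of erf⁻¹), so that
--   (erf⁻¹(√2 z/√π))² = V(z)²/2   and
--   √π ∫_0^{z√2/√π} erf⁻¹(x) dx = ∫_0^z V(t) dt.
Vser : Series
Vser = oddS (λ k → c k *ℚ (invℕ (suc (2 * k)) *ℚ inv2^ k))

-- −(erf⁻¹(√2 z/√π))² = −V(z)²/2
minusErfInvSq : Series
minusErfInvSq n = Data.Rational.-_ (((Vser ⊛ Vser) n) *ℚ invℕ 2)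

-- The root of an increasing bilabelled tree on n nodes carries the labels 1 and 2. Cutting off its first
-- subtree leaves an increasing tree on k nodes, labelled by any 2k of the other 2n − 2 labels, and one on
-- n − k nodes; hence T_n = Σ_k C(2n−2, 2k) T_k T_{n−k}. Comparing with the recurrence of
-- c_m gives T_{m+1} = (2m)!/2^m c_m by strong induction. For V = Σ_k c_k z^(2k+1)/((2k+1) 2^k) this says
-- T' = V and T V' = V' − 1, so Y = 1 − T solves the linear equation Y' = −V V' Y with Y(0) = 1, which
-- determines a formal power series uniquely; exp(−V²/2) solves it as well.
module Submission where

open import Defs
open import Data.Nat using (ℕ; zero; suc; _+_; _*_; _∸_; _^_; _≤_; _<_; z≤n; s≤s; NonZero)
open import Data.Nat.Base using (_!)
open import Data.Nat.Combinatorics using (_C_)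
import Data.Nat.Combinatorics as Combinatorics
open import Data.Nat.Properties using (m^n≢0)
import Data.Nat.Properties as ℕₚ
import Data.Nat.DivMod as DivMod
import Data.Nat.Solver as ℕSolver
open import Data.Nat.ListAction using (sum)
open import Data.Integer using (ℤ; +_) renaming (_*_ to _*ℤ_; _+_ to _+ℤ_)
import Data.Integer.Properties as ℤₚ
import Data.Integer.Solver as ℤSolver
import Data.Integer.GCD as ℤGCD
open import Data.Rational using (ℚ; 0ℚ; 1ℚ; ↥_; ↧_; toℚᵘ) renaming (_+_ to _+ℚ_; _*_ to _*ℚ_; _/_ to _/ℚ_; -_ to -ℚ_; _-_ to _-ℚ_)
import Data.Rational.Properties as ℚₚ
import Data.Rational.Unnormalised as ℚᵘ
import Data.Rational.Unnormalised.Properties as ℚᵘₚ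
import Data.Rational.Solver as ℚSolver
open import Data.List using (List; []; _∷_; _++_; map; length; upTo; applyUpTo; concatMap; cartesianProductWith)
import Data.List.Properties as Listₚ
open import Data.List.Relation.Unary.All as All using (All; []; _∷_)
import Data.List.Relation.Unary.All.Properties as Allₚ
open import Data.List.Relation.Unary.Any using (here; there)
open import Data.List.Relation.Unary.AllPairs as AllPairs using (AllPairs; []; _∷_)
import Data.List.Relation.Unary.AllPairs.Properties as AllPairsₚ
open import Data.List.Relation.Unary.Unique.Propositional using (Unique)
import Data.List.Relation.Unary.Unique.Propositional.Properties as Uniqueₚ
open import Data.List.Membership.Propositional using (_∈_; find; lose)
import Data.List.Membership.Propositional.Properties as ∈ₚ
open import Data.List.Relation.Binary.Permutation.Propositional using (_↭_; ↭-refl; ↭-reflexive; ↭-sym; ↭-trans; prep)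
import Data.List.Relation.Binary.Permutation.Propositional.Properties as ↭ₚ
open import Data.Product using (Σ; ∃; _×_; _,_; proj₁; proj₂; map₁; map₂)
open import Data.Sum using (_⊎_; inj₁; inj₂)
open import Data.Unit using (tt)
open import Data.Empty using (⊥; ⊥-elim)
open import Relation.Binary.PropositionalEquality using (_≡_; refl; sym; trans; cong; cong₂; subst; module ≡-Reasoning)
open import Function using (_∘_)

private variable
  A B E : Set

∈-concatMap⁺′ : (g : A → List B) {x : A} {xs : List A} {z : B} → x ∈ xs → z ∈ g x → z ∈ concatMap g xs
∈-concatMap⁺′ g x∈xs z∈gx = ∈ₚ.∈-concatMap⁺ g (lose x∈xs z∈gx)

∈-concatMap⁻′ : (g : A → List B) (xs : List A) {z : B} → z ∈ concatMap g xs → ∃ λ x → x ∈ xs × z ∈ g x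
∈-concatMap⁻′ g xs z∈ = find (∈ₚ.∈-concatMap⁻ g z∈)

length-concatMap : (g : A → List B) (xs : List A) → length (concatMap g xs) ≡ sum (map (length ∘ g) xs)
length-concatMap g []       = refl
length-concatMap g (x ∷ xs) = trans (Listₚ.length-++ (g x)) (cong (λ n → length (g x) + n) (length-concatMap g xs))

length-cartesianProductWith : (f : A → B → E) (xs : List A) (ys : List B) →
  length (cartesianProductWith f xs ys) ≡ length xs * length ys
length-cartesianProductWith f []       ys = refl
length-cartesianProductWith f (x ∷ xs) ys = begin
  length (map (f x) ys ++ cartesianProductWith f xs ys)          ≡⟨ Listₚ.length-++ (map (f x) ys) ⟩
  length (map (f x) ys) + length (cartesianProductWith f xs ys)  ≡⟨ cong₂ _+_ (Listₚ.length-map (f x) ys) (length-cartesianProductWith f xs ys) ⟩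
  length ys + length xs * length ys                              ∎
  where open ≡-Reasoning

sum-map-cong : (g h : A → ℕ) (xs : List A) → (∀ x → x ∈ xs → g x ≡ h x) → sum (map g xs) ≡ sum (map h xs)
sum-map-cong g h xs g≡h = cong sum (Listₚ.map-cong-local (All.tabulate (λ {x} → g≡h x)))

sum-map-const : (g : A → ℕ) (v : ℕ) (xs : List A) → (∀ x → x ∈ xs → g x ≡ v) → sum (map g xs) ≡ length xs * v
sum-map-const g v []       _   = refl
sum-map-const g v (x ∷ xs) g≡v = cong₂ _+_ (g≡v x (here refl)) (sum-map-const g v xs (λ y y∈ → g≡v y (there y∈)))

concatMap-unique : (g : A → List B) (xs : List A) → Unique xs → (∀ x → x ∈ xs → Unique (g x)) →
  (∀ x y {z} → x ∈ xs → y ∈ xs → z ∈ g x → z ∈ g y → x ≡ y) → Unique (concatMap g xs)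
concatMap-unique g []       _            _       _        = []
concatMap-unique g (x ∷ xs) (x∉xs ∷ uxs) unique-g disjoint =
  Uniqueₚ.++⁺ (unique-g x (here refl))
              (concatMap-unique g xs uxs (λ y y∈ → unique-g y (there y∈)) (λ a b a∈ b∈ → disjoint a b (there a∈) (there b∈)))
              (λ (z∈gx , z∈rest) → apart z∈gx z∈rest)
  where
  apart : ∀ {z} → z ∈ g x → z ∈ concatMap g xs → ⊥
  apart z∈gx z∈rest with y , y∈xs , z∈gy ← ∈-concatMap⁻′ g xs z∈rest =
    All.lookup x∉xs y∈xs (disjoint x y (here refl) (there y∈xs) z∈gx z∈gy)

splits : ℕ → List A → List (List A × List A)
splits zero    xs       = ([] , xs) ∷ []
splits (suc j) []       = []
splits (suc j) (x ∷ xs) = map (map₁ (x ∷_)) (splits j xs) ++ map (map₂ (x ∷_)) (splits (suc j) xs)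

∈-splits⁻ : ∀ j (x : A) xs {p} → p ∈ splits (suc j) (x ∷ xs) →
  (∃ λ q → q ∈ splits j xs × p ≡ map₁ (x ∷_) q) ⊎ (∃ λ q → q ∈ splits (suc j) xs × p ≡ map₂ (x ∷_) q)
∈-splits⁻ j x xs p∈ with ∈ₚ.∈-++⁻ (map (map₁ (x ∷_)) (splits j xs)) p∈
... | inj₁ p∈picked  = inj₁ (∈ₚ.∈-map⁻ (map₁ (x ∷_)) p∈picked)
... | inj₂ p∈skipped = inj₂ (∈ₚ.∈-map⁻ (map₂ (x ∷_)) p∈skipped)

∈-splits-pick : ∀ j (x : A) xs {q} → q ∈ splits j xs → map₁ (x ∷_) q ∈ splits (suc j) (x ∷ xs)
∈-splits-pick j x xs q∈ = ∈ₚ.∈-++⁺ˡ (∈ₚ.∈-map⁺ (map₁ (x ∷_)) q∈)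

∈-splits-skip : ∀ j (x : A) xs {q} → q ∈ splits j xs → map₂ (x ∷_) q ∈ splits j (x ∷ xs)
∈-splits-skip zero    x xs (here refl) = here refl
∈-splits-skip (suc j) x xs q∈          = ∈ₚ.∈-++⁺ʳ (map (map₁ (x ∷_)) (splits j xs)) (∈ₚ.∈-map⁺ (map₂ (x ∷_)) q∈)

splits-↭ : ∀ j (xs : List A) {p} → p ∈ splits j xs → proj₁ p ++ proj₂ p ↭ xs
splits-↭ zero    xs       (here refl) = ↭-refl
splits-↭ (suc j) (x ∷ xs) p∈ with ∈-splits⁻ j x xs p∈
... | inj₁ (q , q∈ , refl) = prep x (splits-↭ j xs q∈)
... | inj₂ (q , q∈ , refl) = ↭-trans (↭ₚ.shift x (proj₁ q) (proj₂ q)) (prep x (splits-↭ (suc j) xs q∈))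

splits-length : ∀ j (xs : List A) {p} → p ∈ splits j xs → length (proj₁ p) ≡ j
splits-length zero    xs       (here refl) = refl
splits-length (suc j) (x ∷ xs) p∈ with ∈-splits⁻ j x xs p∈
... | inj₁ (q , q∈ , refl) = cong suc (splits-length j xs q∈)
... | inj₂ (q , q∈ , refl) = splits-length (suc j) xs q∈

splits-⊆₁ : ∀ j (xs : List A) {p} → p ∈ splits j xs → ∀ {z} → z ∈ proj₁ p → z ∈ xs
splits-⊆₁ j xs p∈ z∈ = ↭ₚ.∈-resp-↭ (splits-↭ j xs p∈) (∈ₚ.∈-++⁺ˡ z∈)

splits-⊆₂ : ∀ j (xs : List A) {p} → p ∈ splits j xs → ∀ {z} → z ∈ proj₂ p → z ∈ xs
splits-⊆₂ j xs {p} p∈ z∈ = ↭ₚ.∈-resp-↭ (splits-↭ j xs p∈) (∈ₚ.∈-++⁺ʳ (proj₁ p) z∈)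

splits-AllPairs : ∀ {R : A → A → Set} j xs {p} → AllPairs R xs → p ∈ splits j xs → AllPairs R (proj₁ p) × AllPairs R (proj₂ p)
splits-AllPairs zero    xs       ps          (here refl) = [] , ps
splits-AllPairs (suc j) (x ∷ xs) (x≺ ∷ ps) p∈ with ∈-splits⁻ j x xs p∈
... | inj₁ (q , q∈ , refl) = let ps₁ , ps₂ = splits-AllPairs j xs ps q∈ in
  (Allₚ.anti-mono (splits-⊆₁ j xs q∈) x≺ ∷ ps₁) , ps₂
... | inj₂ (q , q∈ , refl) = let ps₁ , ps₂ = splits-AllPairs (suc j) xs ps q∈ in
  ps₁ , (Allₚ.anti-mono (splits-⊆₂ (suc j) xs q∈) x≺ ∷ ps₂)

length-splits : ∀ j (xs : List A) → length (splits j xs) ≡ length xs C j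
length-splits zero    xs       = refl
length-splits (suc j) []       = refl
length-splits (suc j) (x ∷ xs) = begin
  length (map (map₁ (x ∷_)) (splits j xs) ++ map (map₂ (x ∷_)) (splits (suc j) xs))
    ≡⟨ Listₚ.length-++ (map (map₁ (x ∷_)) (splits j xs)) ⟩
  length (map (map₁ (x ∷_)) (splits j xs)) + length (map (map₂ (x ∷_)) (splits (suc j) xs))
    ≡⟨ cong₂ _+_ (Listₚ.length-map (map₁ (x ∷_)) (splits j xs)) (Listₚ.length-map (map₂ (x ∷_)) (splits (suc j) xs)) ⟩
  length (splits j xs) + length (splits (suc j) xs)
    ≡⟨ cong₂ _+_ (length-splits j xs) (length-splits (suc j) xs) ⟩
  length xs C j + length xs C suc j
    ≡⟨ Combinatorics.nCk+nC[k+1]≡[n+1]C[k+1] (length xs) j ⟩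
  suc (length xs) C suc j ∎
  where open ≡-Reasoning

shiftˡ : ∀ {x : A} xs ys zs → (xs ++ x ∷ ys) ++ zs ↭ x ∷ ((xs ++ ys) ++ zs)
shiftˡ {x = x} xs ys zs = ↭-trans (↭-reflexive (Listₚ.++-assoc xs (x ∷ ys) zs))
  (↭-trans (↭ₚ.shift x xs (ys ++ zs)) (prep x (↭-reflexive (sym (Listₚ.++-assoc xs ys zs)))))

shiftʳ : ∀ {x : A} xs ys zs → xs ++ (ys ++ x ∷ zs) ↭ x ∷ (xs ++ (ys ++ zs))
shiftʳ {x = x} xs ys zs = ↭-trans (↭-reflexive (sym (Listₚ.++-assoc xs ys (x ∷ zs))))
  (↭-trans (↭ₚ.shift x (xs ++ ys) zs) (prep x (↭-reflexive (Listₚ.++-assoc xs ys zs))))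

splits-complete : ∀ (xs ys zs : List A) → ys ++ zs ↭ xs →
  ∃ λ p → p ∈ splits (length ys) xs × ys ↭ proj₁ p × zs ↭ proj₂ p
splits-complete []       []       zs perm = ([] , []) , here refl , ↭-refl , perm
splits-complete []       (y ∷ ys) zs perm = ⊥-elim (↭ₚ.¬x∷xs↭[] perm)
splits-complete (x ∷ xs) ys zs perm with ∈ₚ.∈-++⁻ ys (↭ₚ.∈-resp-↭ (↭-sym perm) (here refl))
... | inj₁ x∈ys with ys₁ , ys₂ , refl ← ∈ₚ.∈-∃++ x∈ys
                   with p , p∈ , ys↭ , zs↭ ← splits-complete xs (ys₁ ++ ys₂) zs (↭ₚ.drop-∷ (↭-trans (↭-sym (shiftˡ ys₁ ys₂ zs)) perm))
  = map₁ (x ∷_) p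
  , subst (λ l → map₁ (x ∷_) p ∈ splits l (x ∷ xs)) (sym (↭ₚ.↭-length (↭ₚ.shift x ys₁ ys₂))) (∈-splits-pick _ x xs p∈)
  , ↭-trans (↭ₚ.shift x ys₁ ys₂) (prep x ys↭) , zs↭
... | inj₂ x∈zs with zs₁ , zs₂ , refl ← ∈ₚ.∈-∃++ x∈zs
                   with p , p∈ , ys↭ , zs↭ ← splits-complete xs ys (zs₁ ++ zs₂) (↭ₚ.drop-∷ (↭-trans (↭-sym (shiftʳ ys zs₁ zs₂)) perm))
  = map₂ (x ∷_) p , ∈-splits-skip (length ys) x xs p∈ , ys↭ , ↭-trans (↭ₚ.shift x zs₁ zs₂) (prep x zs↭)

splits-unique : ∀ j (xs : List A) → Unique xs → Unique (splits j xs)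
splits-unique zero    xs       _            = [] ∷ []
splits-unique (suc j) []       _            = []
splits-unique (suc j) (x ∷ xs) (x∉xs ∷ uxs) =
  Uniqueₚ.++⁺ (Uniqueₚ.map⁺ pick-injective (splits-unique j xs uxs))
              (Uniqueₚ.map⁺ skip-injective (splits-unique (suc j) xs uxs))
              (λ (p∈picked , p∈skipped) → apart p∈picked p∈skipped)
  where
  pick-injective : ∀ {p q} → map₁ (x ∷_) p ≡ map₁ (x ∷_) q → p ≡ q
  pick-injective {_ , _} {_ , _} refl = refl
  skip-injective : ∀ {p q} → map₂ (x ∷_) p ≡ map₂ (x ∷_) q → p ≡ q
  skip-injective {_ , _} {_ , _} refl = refl
  apart : ∀ {p} → p ∈ map (map₁ (x ∷_)) (splits j xs) → p ∈ map (map₂ (x ∷_)) (splits (suc j) xs) → ⊥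
  apart p∈picked p∈skipped with q , _ , refl ← ∈ₚ.∈-map⁻ (map₁ (x ∷_)) p∈picked
                              | q′ , q′∈ , eq ← ∈ₚ.∈-map⁻ (map₂ (x ∷_)) p∈skipped =
    All.lookup x∉xs (splits-⊆₁ (suc j) xs q′∈ (subst (x ∈_) (cong proj₁ eq) (here refl))) refl

splits-determined : ∀ j (xs : List A) → Unique xs → ∀ {p p′} → p ∈ splits j xs → p′ ∈ splits j xs →
  proj₁ p ↭ proj₁ p′ → p ≡ p′
splits-determined zero    xs       _            (here refl) (here refl) _ = refl
splits-determined (suc j) (x ∷ xs) (x∉xs ∷ uxs) p∈ p′∈ picked↭ with ∈-splits⁻ j x xs p∈ | ∈-splits⁻ j x xs p′∈
... | inj₁ (q , q∈ , refl) | inj₁ (q′ , q′∈ , refl) = cong (map₁ (x ∷_)) (splits-determined j xs uxs q∈ q′∈ (↭ₚ.drop-∷ picked↭))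
... | inj₁ (q , q∈ , refl) | inj₂ (q′ , q′∈ , refl) =
  ⊥-elim (All.lookup x∉xs (splits-⊆₁ (suc j) xs q′∈ (↭ₚ.∈-resp-↭ picked↭ (here refl))) refl)
... | inj₂ (q , q∈ , refl) | inj₁ (q′ , q′∈ , refl) =
  ⊥-elim (All.lookup x∉xs (splits-⊆₁ (suc j) xs q∈ (↭ₚ.∈-resp-↭ (↭-sym picked↭) (here refl))) refl)
... | inj₂ (q , q∈ , refl) | inj₂ (q′ , q′∈ , refl) = cong (map₂ (x ∷_)) (splits-determined (suc j) xs uxs q∈ q′∈ picked↭)

-- Enumerating increasing bilabelled trees

Sorted : List ℕ → Set
Sorted = AllPairs _<_

IsBITOn : ℕ → List ℕ → BTree → Set
IsBITOn n L t = size t ≡ n × Incr t × labels t ↭ L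

graft : BTree → BTree → BTree
graft t₁ (node a b ts) = node a b (t₁ ∷ ts)

graft-injective : ∀ {t₁ t₁′ t t′} → graft t₁ t ≡ graft t₁′ t′ → t₁ ≡ t₁′ × t ≡ t′
graft-injective {t = node _ _ _} {t′ = node _ _ _} refl = refl , refl

-- The first argument of enumBIT and countBIT is recursion fuel; both are exact once the fuel is at least n.
mutual
  enumBIT : ℕ → ℕ → List ℕ → List BTree
  enumBIT (suc f) (suc zero)    (x ∷ y ∷ [])   = node x y [] ∷ []
  enumBIT (suc f) (suc (suc m)) (x ∷ y ∷ rest) = concatMap (withFirstSubtree f (suc (suc m)) x y rest) (applyUpTo suc (suc m))
  enumBIT _       _             _              = []

  withFirstSubtree : ℕ → ℕ → ℕ → ℕ → List ℕ → ℕ → List BTree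
  withFirstSubtree f n x y rest k = concatMap
    (λ p → cartesianProductWith graft (enumBIT f k (proj₁ p)) (enumBIT f (n ∸ k) (x ∷ y ∷ proj₂ p)))
    (splits (2 * k) rest)

countBIT : ℕ → ℕ → ℕ
countBIT (suc f) (suc zero)    = 1
countBIT (suc f) (suc (suc m)) =
  sum (map (λ k → ((2 * suc (suc m) ∸ 2) C (2 * k)) * countBIT f k * countBIT f (suc (suc m) ∸ k)) (applyUpTo suc (suc m)))
countBIT _       _             = 0

∈-withFirstSubtree⁻ : ∀ f n x y rest k {t} → t ∈ withFirstSubtree f n x y rest k →
  ∃ λ p → p ∈ splits (2 * k) rest × ∃ λ t₁ → ∃ λ t₂ →
    t₁ ∈ enumBIT f k (proj₁ p) × t₂ ∈ enumBIT f (n ∸ k) (x ∷ y ∷ proj₂ p) × t ≡ graft t₁ t₂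
∈-withFirstSubtree⁻ f n x y rest k t∈
  with p , p∈ , t∈p ← ∈-concatMap⁻′ _ (splits (2 * k) rest) t∈
  with t₁ , t₂ , t₁∈ , t₂∈ , refl ← ∈ₚ.∈-cartesianProductWith⁻ graft _ _ t∈p
  = p , p∈ , t₁ , t₂ , t₁∈ , t₂∈ , refl

∈-enumBIT⁻ : ∀ f m x y rest {t} → t ∈ enumBIT (suc f) (suc (suc m)) (x ∷ y ∷ rest) →
  ∃ λ k → k ∈ applyUpTo suc (suc m) × ∃ λ p → p ∈ splits (2 * k) rest × ∃ λ t₁ → ∃ λ t₂ →
    t₁ ∈ enumBIT f k (proj₁ p) × t₂ ∈ enumBIT f (suc (suc m) ∸ k) (x ∷ y ∷ proj₂ p) × t ≡ graft t₁ t₂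
∈-enumBIT⁻ f m x y rest t∈
  with k , k∈ , t∈k ← ∈-concatMap⁻′ (withFirstSubtree f (suc (suc m)) x y rest) (applyUpTo suc (suc m)) t∈
  = k , k∈ , ∈-withFirstSubtree⁻ f (suc (suc m)) x y rest k t∈k

∈-enumBIT⁺ : ∀ f m x y rest {k p t₁ t₂} → k ∈ applyUpTo suc (suc m) → p ∈ splits (2 * k) rest →
  t₁ ∈ enumBIT f k (proj₁ p) → t₂ ∈ enumBIT f (suc (suc m) ∸ k) (x ∷ y ∷ proj₂ p) →
  graft t₁ t₂ ∈ enumBIT (suc f) (suc (suc m)) (x ∷ y ∷ rest)
∈-enumBIT⁺ f m x y rest k∈ p∈ t₁∈ t₂∈ =
  ∈-concatMap⁺′ (withFirstSubtree f (suc (suc m)) x y rest) k∈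
    (∈-concatMap⁺′ _ p∈ (∈ₚ.∈-cartesianProductWith⁺ graft t₁∈ t₂∈))

∈-applyUpTo-suc⁻ : ∀ {m k} → k ∈ applyUpTo suc m → 1 ≤ k × k ≤ m
∈-applyUpTo-suc⁻ k∈ with i , i<m , refl ← ∈ₚ.∈-applyUpTo⁻ suc k∈ = s≤s z≤n , i<m

mutual
  labels-length : ∀ t → length (labels t) ≡ 2 * size t
  labels-length (node a b ts) = trans (cong (suc ∘ suc) (labelsF-length ts)) (sym (ℕₚ.*-suc 2 (sizes ts)))

  labelsF-length : ∀ ts → length (labelsF ts) ≡ 2 * sizes ts
  labelsF-length []       = refl
  labelsF-length (t ∷ ts) = begin
    length (labels t ++ labelsF ts)               ≡⟨ Listₚ.length-++ (labels t) ⟩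
    length (labels t) + length (labelsF ts)       ≡⟨ cong₂ _+_ (labels-length t) (labelsF-length ts) ⟩
    2 * size t + 2 * sizes ts                     ≡⟨ ℕₚ.*-distribˡ-+ 2 (size t) (sizes ts) ⟨
    2 * (size t + sizes ts)                       ∎
    where open ≡-Reasoning

IncrF-labels-above : ∀ a b ts → IncrF a b ts → All (b <_) (labelsF ts)
IncrF-labels-above a b []                     _ = []
IncrF-labels-above a b (node a′ b′ us ∷ ts) ((_ , b<a′ , _ , b<b′) , (_ , incr) , incrs) =
  Allₚ.++⁺ (b<a′ ∷ b<b′ ∷ All.map (ℕₚ.<-trans b<b′) (IncrF-labels-above a′ b′ us incr)) (IncrF-labels-above a b ts incrs)

↭-least-head : ∀ {a x l l′} → All (a <_) l → All (x <_) l′ → a ∷ l ↭ x ∷ l′ → a ≡ x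
↭-least-head {a} {x} a<l x<l′ perm with ↭ₚ.∈-resp-↭ perm (here refl) | ↭ₚ.∈-resp-↭ (↭-sym perm) (here refl)
... | here a≡x  | _         = a≡x
... | there _   | here x≡a  = sym x≡a
... | there a∈l′ | there x∈l = ⊥-elim (ℕₚ.<-asym (All.lookup x<l′ a∈l′) (All.lookup a<l x∈l))

root-labels : ∀ a b ts x y rest → Incr (node a b ts) → Sorted (x ∷ y ∷ rest) → labels (node a b ts) ↭ x ∷ y ∷ rest →
  a ≡ x × b ≡ y × labelsF ts ↭ rest
root-labels a b ts x y rest (a<b , incr) ((x<y ∷ x<rest) ∷ (y<rest ∷ _)) perm
  with refl ← ↭-least-head (a<b ∷ All.map (ℕₚ.<-trans a<b) (IncrF-labels-above a b ts incr)) (x<y ∷ x<rest) perm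
  with refl ← ↭-least-head (IncrF-labels-above a b ts incr) y<rest (↭ₚ.drop-∷ perm)
  = refl , refl , ↭ₚ.drop-∷ (↭ₚ.drop-∷ perm)

sorted-∷∷-⊆ : ∀ {x y rest R} → Sorted (x ∷ y ∷ rest) → Sorted R → (∀ {z} → z ∈ R → z ∈ rest) → Sorted (x ∷ y ∷ R)
sorted-∷∷-⊆ ((x<y ∷ x<rest) ∷ (y<rest ∷ _)) sortedR R⊆rest = (x<y ∷ Allₚ.anti-mono R⊆rest x<rest) ∷ (Allₚ.anti-mono R⊆rest y<rest ∷ sortedR)

splits-rest-sorted : ∀ {x y rest} j {p} → Sorted (x ∷ y ∷ rest) → p ∈ splits j rest → Sorted (x ∷ y ∷ proj₂ p)
splits-rest-sorted {rest = rest} j sorted@(_ ∷ _ ∷ sortedRest) p∈ =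
  sorted-∷∷-⊆ sorted (proj₂ (splits-AllPairs j rest sortedRest p∈)) (splits-⊆₂ j rest p∈)

graft-IsBITOn : ∀ {n k x y rest p t₁ t₂} → k ≤ n → Sorted (x ∷ y ∷ rest) → p ∈ splits (2 * k) rest →
  IsBITOn k (proj₁ p) t₁ → IsBITOn (n ∸ k) (x ∷ y ∷ proj₂ p) t₂ → IsBITOn n (x ∷ y ∷ rest) (graft t₁ t₂)
graft-IsBITOn {n} {k} {x} {y} {rest} {p} {t₁@(node a₁ b₁ us)} {node a b ts} k≤n
  sorted@((x<y ∷ x<rest) ∷ (y<rest ∷ _)) p∈ (size₁ , incr₁ , perm₁) (size₂ , incr₂@(_ , incrs) , perm₂)
  with refl , refl , permF ← root-labels a b ts x y (proj₂ p) incr₂ (splits-rest-sorted (2 * k) sorted p∈) perm₂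
  = size≡ , (x<y , ((above x<rest a₁∈ , above y<rest a₁∈ , above x<rest b₁∈ , above y<rest b₁∈) , incr₁ , incrs))
  , prep x (prep y (↭-trans (↭ₚ.++⁺ perm₁ permF) (splits-↭ (2 * k) rest p∈)))
  where
  open ≡-Reasoning
  above : ∀ {v z} → All (v <_) rest → z ∈ rest → v < z
  above v<rest z∈ = All.lookup v<rest z∈
  a₁∈ : a₁ ∈ rest
  a₁∈ = splits-⊆₁ (2 * k) rest p∈ (↭ₚ.∈-resp-↭ perm₁ (here refl))
  b₁∈ : b₁ ∈ rest
  b₁∈ = splits-⊆₁ (2 * k) rest p∈ (↭ₚ.∈-resp-↭ perm₁ (there (here refl)))
  size≡ : suc (size t₁ + sizes ts) ≡ n
  size≡ = begin
    suc (size t₁ + sizes ts)   ≡⟨ ℕₚ.+-suc (size t₁) (sizes ts) ⟨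
    size t₁ + suc (sizes ts)   ≡⟨ cong₂ _+_ size₁ size₂ ⟩
    k + (n ∸ k)                ≡⟨ ℕₚ.m+[n∸m]≡n k≤n ⟩
    n                          ∎

enumBIT-sound : ∀ f n L t → Sorted L → t ∈ enumBIT f n L → IsBITOn n L t
enumBIT-sound (suc f) (suc zero) (x ∷ y ∷ []) _ ((x<y ∷ _) ∷ _) (here refl) = refl , (x<y , tt) , ↭-refl
enumBIT-sound (suc f) (suc (suc m)) (x ∷ y ∷ rest) t sorted@(_ ∷ _ ∷ sortedRest) t∈
  with k , k∈ , p , p∈ , t₁ , t₂ , t₁∈ , t₂∈ , refl ← ∈-enumBIT⁻ f m x y rest t∈
  = graft-IsBITOn (ℕₚ.m≤n⇒m≤1+n (proj₂ (∈-applyUpTo-suc⁻ k∈))) sorted p∈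
      (enumBIT-sound f k (proj₁ p) t₁ (proj₁ (splits-AllPairs (2 * k) rest sortedRest p∈)) t₁∈)
      (enumBIT-sound f (suc (suc m) ∸ k) (x ∷ y ∷ proj₂ p) t₂ (splits-rest-sorted (2 * k) sorted p∈) t₂∈)

enumBIT-complete : ∀ f n L t → n ≤ f → Sorted L → IsBITOn n L t → t ∈ enumBIT f n L
enumBIT-complete zero    _ _        (node _ _ _) z≤n _ (() , _)
enumBIT-complete (suc f) _ []       (node _ _ _) _   _ (_ , _ , perm) = ⊥-elim (↭ₚ.¬x∷xs↭[] perm)
enumBIT-complete (suc f) _ (_ ∷ []) (node _ _ _) _   _ (_ , _ , perm) with () ← ↭ₚ.↭-length perm
enumBIT-complete (suc f) _ (x ∷ y ∷ rest) (node a b []) _ sorted (refl , incr , perm)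
  with refl , refl , permF ← root-labels a b [] x y rest incr sorted perm
  with refl ← ↭ₚ.↭-empty-inv (↭-sym permF)
  = here refl
enumBIT-complete (suc f) _ (x ∷ y ∷ rest) (node a b (t₁@(node a₁ b₁ us) ∷ ts)) (s≤s n≤f) sorted@(_ ∷ _ ∷ sortedRest)
  (refl , incr@(_ , (_ , incr₁ , incrs)) , perm)
  with refl , refl , permF ← root-labels a b (t₁ ∷ ts) x y rest incr sorted perm
  with p , p∈ , perm₁ , permRest ← splits-complete rest (labels t₁) (labelsF ts) permF
  = ∈-enumBIT⁺ f (sizes us + sizes ts) x y rest k∈ p∈′
      (enumBIT-complete f k (proj₁ p) t₁ k≤f (proj₁ (splits-AllPairs (2 * k) rest sortedRest p∈′)) (refl , incr₁ , perm₁))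
      (enumBIT-complete f (n ∸ k) (x ∷ y ∷ proj₂ p) (node x y ts) n∸k≤f (splits-rest-sorted (2 * k) sorted p∈′)
        (size-rest , (proj₁ incr , incrs) , prep x (prep y permRest)))
  where
  k = suc (sizes us)
  n = suc (suc (sizes us + sizes ts))
  k∈ : k ∈ applyUpTo suc (suc (sizes us + sizes ts))
  k∈ = ∈ₚ.∈-applyUpTo⁺ suc (s≤s (ℕₚ.m≤m+n (sizes us) (sizes ts)))
  p∈′ : p ∈ splits (2 * k) rest
  p∈′ = subst (λ j → p ∈ splits j rest) (labels-length t₁) p∈
  k≤f : k ≤ f
  k≤f = ℕₚ.≤-trans (ℕₚ.m≤m+n k (sizes ts)) n≤f
  size-rest : suc (sizes ts) ≡ n ∸ k
  size-rest = sym (trans (cong (_∸ k) (sym (ℕₚ.+-suc k (sizes ts)))) (ℕₚ.m+n∸m≡n k (suc (sizes ts))))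
  n∸k≤f : n ∸ k ≤ f
  n∸k≤f = subst (_≤ f) size-rest (ℕₚ.≤-trans (s≤s (ℕₚ.m≤n+m (sizes ts) (sizes us))) n≤f)

sorted⇒unique : ∀ {L} → Sorted L → Unique L
sorted⇒unique = AllPairs.map ℕₚ.<⇒≢

-- The catch-all clause of enumBIT only reduces once fuel, size and label list are all split.
enumBIT-unique : ∀ f n L → Sorted L → Unique (enumBIT f n L)
enumBIT-unique zero    _             _              _ = []
enumBIT-unique (suc f) zero          _              _ = []
enumBIT-unique (suc f) (suc zero)    []             _ = []
enumBIT-unique (suc f) (suc zero)    (_ ∷ [])       _ = []
enumBIT-unique (suc f) (suc zero)    (x ∷ y ∷ [])   _ = [] ∷ []
enumBIT-unique (suc f) (suc zero)    (_ ∷ _ ∷ _ ∷ _) _ = []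
enumBIT-unique (suc f) (suc (suc m)) []             _ = []
enumBIT-unique (suc f) (suc (suc m)) (_ ∷ [])       _ = []
enumBIT-unique (suc f) (suc (suc m)) (x ∷ y ∷ rest) sorted@(_ ∷ _ ∷ sortedRest) =
  concatMap-unique (withFirstSubtree f n x y rest) (applyUpTo suc (suc m))
    (Uniqueₚ.applyUpTo⁺₁ suc (suc m) (λ i<j _ i≡j → ℕₚ.<-irrefl (ℕₚ.suc-injective i≡j) i<j))
    (λ k _ → unique-k k) same-k
  where
  n = suc (suc m)
  uniqueRest = sorted⇒unique sortedRest
  unique-k : ∀ k → Unique (withFirstSubtree f n x y rest k)
  unique-k k = concatMap-unique _ (splits (2 * k) rest) (splits-unique (2 * k) rest uniqueRest)
    (λ p p∈ → Uniqueₚ.cartesianProductWith⁺ graft graft-injective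
      (enumBIT-unique f k (proj₁ p) (proj₁ (splits-AllPairs (2 * k) rest sortedRest p∈)))
      (enumBIT-unique f (n ∸ k) (x ∷ y ∷ proj₂ p) (splits-rest-sorted (2 * k) sorted p∈)))
    same-p
    where
    labels-of : ∀ p {t₁} → p ∈ splits (2 * k) rest → t₁ ∈ enumBIT f k (proj₁ p) → labels t₁ ↭ proj₁ p
    labels-of p p∈ t₁∈ = proj₂ (proj₂ (enumBIT-sound f k (proj₁ p) _ (proj₁ (splits-AllPairs (2 * k) rest sortedRest p∈)) t₁∈))
    same-p : ∀ p p′ {t} → p ∈ splits (2 * k) rest → p′ ∈ splits (2 * k) rest →
      t ∈ _ → t ∈ _ → p ≡ p′
    same-p p p′ p∈ p′∈ t∈ t∈′
      with t₁ , _ , t₁∈ , _ , refl ← ∈ₚ.∈-cartesianProductWith⁻ graft _ _ t∈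
         | t₁′ , _ , t₁′∈ , _ , eq ← ∈ₚ.∈-cartesianProductWith⁻ graft _ _ t∈′
      with refl , _ ← graft-injective eq
      = splits-determined (2 * k) rest uniqueRest p∈ p′∈
          (↭-trans (↭-sym (labels-of p p∈ t₁∈)) (labels-of p′ p′∈ t₁′∈))
  same-k : ∀ k k′ {t} → k ∈ applyUpTo suc (suc m) → k′ ∈ applyUpTo suc (suc m) →
    t ∈ withFirstSubtree f n x y rest k → t ∈ withFirstSubtree f n x y rest k′ → k ≡ k′
  same-k k k′ _ _ t∈ t∈′
    with p , p∈ , t₁ , _ , t₁∈ , _ , refl ← ∈-withFirstSubtree⁻ f n x y rest k t∈
       | p′ , p′∈ , t₁′ , _ , t₁′∈ , _ , eq ← ∈-withFirstSubtree⁻ f n x y rest k′ t∈′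
    with refl , _ ← graft-injective eq
    = trans (sym (proj₁ (enumBIT-sound f k (proj₁ p) t₁ (proj₁ (splits-AllPairs (2 * k) rest sortedRest p∈)) t₁∈)))
            (proj₁ (enumBIT-sound f k′ (proj₁ p′) t₁ (proj₁ (splits-AllPairs (2 * k′) rest sortedRest p′∈)) t₁′∈))

length-remaining : ∀ {k d m r} → k + d ≡ suc (suc m) → 2 * k + r ≡ 2 * suc (suc m) ∸ 2 → suc (suc r) ≡ 2 * d
length-remaining {k} {d} {m} {r} k+d≡n 2k+r≡2n-2 = ℕₚ.+-cancelˡ-≡ (2 * k) _ _ (begin
  2 * k + suc (suc r)       ≡⟨ ℕₚ.+-suc (2 * k) (suc r) ⟩
  suc (2 * k + suc r)       ≡⟨ cong suc (ℕₚ.+-suc (2 * k) r) ⟩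
  suc (suc (2 * k + r))     ≡⟨ cong (suc ∘ suc) 2k+r≡2n-2 ⟩
  2 * suc (suc m)           ≡⟨ cong (2 *_) k+d≡n ⟨
  2 * (k + d)               ≡⟨ ℕₚ.*-distribˡ-+ 2 k d ⟩
  2 * k + 2 * d             ∎)
  where open ≡-Reasoning

length-enumBIT : ∀ f n L → length L ≡ 2 * n → length (enumBIT f n L) ≡ countBIT f n
length-enumBIT zero    _             _                _  = refl
length-enumBIT (suc f) zero          _                _  = refl
length-enumBIT (suc f) (suc zero)    (x ∷ y ∷ [])     _  = refl
length-enumBIT (suc f) (suc zero)    (_ ∷ _ ∷ _ ∷ _)  ()
length-enumBIT (suc f) (suc (suc m)) (x ∷ y ∷ rest)   len≡ = begin
  length (enumBIT (suc f) n (x ∷ y ∷ rest))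
    ≡⟨ length-concatMap (withFirstSubtree f n x y rest) (applyUpTo suc (suc m)) ⟩
  sum (map (length ∘ withFirstSubtree f n x y rest) (applyUpTo suc (suc m)))
    ≡⟨ sum-map-cong _ _ (applyUpTo suc (suc m)) (λ k k∈ → length-withFirstSubtree k (proj₂ (∈-applyUpTo-suc⁻ k∈))) ⟩
  countBIT (suc f) n ∎
  where
  open ≡-Reasoning
  n = suc (suc m)
  length-rest : length rest ≡ 2 * n ∸ 2
  length-rest = ℕₚ.suc-injective (ℕₚ.suc-injective len≡)
  length-withFirstSubtree : ∀ k → k ≤ suc m →
    length (withFirstSubtree f n x y rest k) ≡ ((2 * n ∸ 2) C (2 * k)) * countBIT f k * countBIT f (n ∸ k)
  length-withFirstSubtree k k≤1+m = begin
    length (withFirstSubtree f n x y rest k)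
      ≡⟨ length-concatMap _ (splits (2 * k) rest) ⟩
    sum (map (λ p → length (cartesianProductWith graft (enumBIT f k (proj₁ p)) (enumBIT f (n ∸ k) (x ∷ y ∷ proj₂ p)))) (splits (2 * k) rest))
      ≡⟨ sum-map-const _ (countBIT f k * countBIT f (n ∸ k)) (splits (2 * k) rest) length-pairs ⟩
    length (splits (2 * k) rest) * (countBIT f k * countBIT f (n ∸ k))
      ≡⟨ cong (_* (countBIT f k * countBIT f (n ∸ k))) (trans (length-splits (2 * k) rest) (cong (_C (2 * k)) length-rest)) ⟩
    ((2 * n ∸ 2) C (2 * k)) * (countBIT f k * countBIT f (n ∸ k))
      ≡⟨ ℕₚ.*-assoc ((2 * n ∸ 2) C (2 * k)) (countBIT f k) (countBIT f (n ∸ k)) ⟨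
    ((2 * n ∸ 2) C (2 * k)) * countBIT f k * countBIT f (n ∸ k) ∎
    where
    length-pairs : ∀ p → p ∈ splits (2 * k) rest →
      length (cartesianProductWith graft (enumBIT f k (proj₁ p)) (enumBIT f (n ∸ k) (x ∷ y ∷ proj₂ p))) ≡ countBIT f k * countBIT f (n ∸ k)
    length-pairs p p∈ = trans (length-cartesianProductWith graft (enumBIT f k (proj₁ p)) (enumBIT f (n ∸ k) (x ∷ y ∷ proj₂ p)))
      (cong₂ _*_ (length-enumBIT f k (proj₁ p) (splits-length (2 * k) rest p∈))
                 (length-enumBIT f (n ∸ k) (x ∷ y ∷ proj₂ p) (length-remaining {k} {n ∸ k} (ℕₚ.m+[n∸m]≡n (ℕₚ.m≤n⇒m≤1+n k≤1+m)) (begin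
                   2 * k + length (proj₂ p)                ≡⟨ cong (_+ length (proj₂ p)) (splits-length (2 * k) rest p∈) ⟨
                   length (proj₁ p) + length (proj₂ p)     ≡⟨ Listₚ.length-++ (proj₁ p) ⟨
                   length (proj₁ p ++ proj₂ p)             ≡⟨ ↭ₚ.↭-length (splits-↭ (2 * k) rest p∈) ⟩
                   length rest                             ≡⟨ length-rest ⟩
                   2 * n ∸ 2                               ∎))))

∈-applyUpTo-suc⇒∸-bound : ∀ {m k} → k ∈ applyUpTo suc (suc m) → suc (suc m) ∸ k ≤ suc m
∈-applyUpTo-suc⇒∸-bound {m} k∈ with i , _ , refl ← ∈ₚ.∈-applyUpTo⁻ suc k∈ = ℕₚ.m∸n≤m (suc m) i

countBIT-fuel : ∀ f g n → n ≤ f → n ≤ g → countBIT f n ≡ countBIT g n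
countBIT-fuel zero    zero    zero          _         _         = refl
countBIT-fuel zero    (suc g) zero          _         _         = refl
countBIT-fuel (suc f) zero    zero          _         _         = refl
countBIT-fuel (suc f) (suc g) zero          _         _         = refl
countBIT-fuel (suc f) (suc g) (suc zero)    _         _         = refl
countBIT-fuel (suc f) (suc g) (suc (suc m)) (s≤s n≤f) (s≤s n≤g) =
  sum-map-cong _ _ (applyUpTo suc (suc m)) λ k k∈ →
    cong₂ (λ a b → ((2 * suc (suc m) ∸ 2) C (2 * k)) * a * b)
      (countBIT-fuel f g k (ℕₚ.≤-trans (proj₂ (∈-applyUpTo-suc⁻ k∈)) n≤f) (ℕₚ.≤-trans (proj₂ (∈-applyUpTo-suc⁻ k∈)) n≤g))
      (countBIT-fuel f g (suc (suc m) ∸ k) (ℕₚ.≤-trans (∈-applyUpTo-suc⇒∸-bound k∈) n≤f) (ℕₚ.≤-trans (∈-applyUpTo-suc⇒∸-bound k∈) n≤g))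

T : ℕ → ℕ
T n = countBIT n n

T-recurrence : ∀ n → 2 ≤ n → T n ≡ sum (map (λ k → ((2 * n ∸ 2) C (2 * k)) * T k * T (n ∸ k)) (applyUpTo suc (n ∸ 1)))
T-recurrence (suc (suc m)) (s≤s (s≤s z≤n)) =
  sum-map-cong _ _ (applyUpTo suc (suc m)) λ k k∈ →
    cong₂ (λ a b → ((2 * suc (suc m) ∸ 2) C (2 * k)) * a * b)
      (countBIT-fuel (suc m) k k (proj₂ (∈-applyUpTo-suc⁻ k∈)) ℕₚ.≤-refl)
      (countBIT-fuel (suc m) (suc (suc m) ∸ k) (suc (suc m) ∸ k) (∈-applyUpTo-suc⇒∸-bound k∈) ℕₚ.≤-refl)

oneTo2n : ℕ → List ℕ
oneTo2n n = map suc (upTo (2 * n))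

oneTo2n-sorted : ∀ n → Sorted (oneTo2n n)
oneTo2n-sorted n = AllPairsₚ.map⁺ (AllPairsₚ.applyUpTo⁺₁ (λ i → i) (2 * n) (λ i<j _ → s≤s i<j))

T-counts : ∀ n → CountIs (IsBIT n) (T n)
T-counts n =
    enumBIT n n (oneTo2n n)
  , enumBIT-unique n n _ (oneTo2n-sorted n)
  , (λ t t∈ → enumBIT-sound n n _ t (oneTo2n-sorted n) t∈)
  , (λ t isBIT → enumBIT-complete n n _ t ℕₚ.≤-refl (oneTo2n-sorted n) isBIT)
  , length-enumBIT n n _ (trans (Listₚ.length-map suc (upTo (2 * n))) (Listₚ.length-applyUpTo (λ i → i) (2 * n)))

toℚᵘ-/ : ∀ (i : ℤ) n .{{_ : NonZero n}} → toℚᵘ (i /ℚ n) ℚᵘ.≃ (i ℚᵘ./ n)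
toℚᵘ-/ i n@(suc _) = ℚᵘ.*≡* (begin
    ℚᵘ.↥ toℚᵘ q *ℤ + n        ≡⟨ cong (_*ℤ + n) (ℚₚ.↥ᵘ-toℚᵘ q) ⟩
    ↥ q *ℤ + n                ≡⟨ cong (↥ q *ℤ_) (ℚₚ.↧-/ i n) ⟨
    ↥ q *ℤ (↧ q *ℤ g)         ≡⟨ swap (↥ q) (↧ q) g ⟩
    (↥ q *ℤ g) *ℤ ↧ q         ≡⟨ cong (_*ℤ ↧ q) (ℚₚ.↥-/ i n) ⟩
    i *ℤ ↧ q                  ≡⟨ cong (i *ℤ_) (ℚₚ.↧ᵘ-toℚᵘ q) ⟨
    i *ℤ ℚᵘ.↧ toℚᵘ q          ∎)
  where
  open ≡-Reasoning
  open ℤSolver.+-*-Solver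
  q = i /ℚ n
  g = ℤGCD.gcd i (+ n)
  swap : ∀ a b c → a *ℤ (b *ℤ c) ≡ (a *ℤ c) *ℤ b
  swap = solve 3 (λ a b c → a :* (b :* c) := (a :* c) :* b) refl

/-≡-cross : ∀ (a : ℤ) b (c : ℤ) d .{{_ : NonZero b}} .{{_ : NonZero d}} →
  a *ℤ + d ≡ c *ℤ + b → a /ℚ b ≡ c /ℚ d
/-≡-cross a b@(suc _) c d@(suc _) eq = ℚₚ.toℚᵘ-injective
  (ℚᵘₚ.≃-trans (toℚᵘ-/ a b) (ℚᵘₚ.≃-trans (ℚᵘ.*≡* eq) (ℚᵘₚ.≃-sym (toℚᵘ-/ c d))))

/-* : ∀ (a : ℤ) b (c : ℤ) d .{{_ : NonZero b}} .{{_ : NonZero d}} →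
  (a /ℚ b) *ℚ (c /ℚ d) ≡ ((a *ℤ c) /ℚ (b * d)) {{ℕₚ.m*n≢0 b d}}
/-* a b@(suc _) c d@(suc _) = ℚₚ.toℚᵘ-injective (ℚᵘₚ.≃-trans (ℚₚ.toℚᵘ-homo-* (a /ℚ b) (c /ℚ d))
  (ℚᵘₚ.≃-trans (ℚᵘₚ.*-cong (toℚᵘ-/ a b) (toℚᵘ-/ c d)) (ℚᵘₚ.≃-sym (toℚᵘ-/ (a *ℤ c) (b * d)))))

/-+ : ∀ (a : ℤ) b (c : ℤ) d .{{_ : NonZero b}} .{{_ : NonZero d}} →
  (a /ℚ b) +ℚ (c /ℚ d) ≡ ((a *ℤ + d +ℤ c *ℤ + b) /ℚ (b * d)) {{ℕₚ.m*n≢0 b d}}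
/-+ a b@(suc _) c d@(suc _) = ℚₚ.toℚᵘ-injective (ℚᵘₚ.≃-trans (ℚₚ.toℚᵘ-homo-+ (a /ℚ b) (c /ℚ d))
  (ℚᵘₚ.≃-trans (ℚᵘₚ.+-cong (toℚᵘ-/ a b) (toℚᵘ-/ c d)) (ℚᵘₚ.≃-sym (toℚᵘ-/ _ (b * d)))))

ℕtoℚ-+ : ∀ m n → ℕtoℚ (m + n) ≡ ℕtoℚ m +ℚ ℕtoℚ n
ℕtoℚ-+ m n = sym (trans (/-+ (+ m) 1 (+ n) 1) (/-≡-cross (+ m *ℤ + 1 +ℤ + n *ℤ + 1) 1 (+ (m + n)) 1 (begin
    (+ m *ℤ + 1 +ℤ + n *ℤ + 1) *ℤ + 1  ≡⟨ solve 2 (λ x y → (x :* con (+ 1) :+ y :* con (+ 1)) :* con (+ 1) := x :+ y) refl (+ m) (+ n) ⟩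
    + m +ℤ + n                         ≡⟨ ℤₚ.pos-+ m n ⟨
    + (m + n)                          ≡⟨ ℤₚ.*-identityʳ _ ⟨
    + (m + n) *ℤ + 1                   ∎)))
  where
  open ≡-Reasoning
  open ℤSolver.+-*-Solver

ℕtoℚ-* : ∀ m n → ℕtoℚ (m * n) ≡ ℕtoℚ m *ℚ ℕtoℚ n
ℕtoℚ-* m n = sym (trans (/-* (+ m) 1 (+ n) 1)
  (/-≡-cross (+ m *ℤ + n) 1 (+ (m * n)) 1 (cong (_*ℤ + 1) (sym (ℤₚ.pos-* m n)))))

ℕtoℚ-sum : ∀ {A : Set} (f : A → ℕ) xs → ℕtoℚ (sum (map f xs)) ≡ sumℚ (map (ℕtoℚ ∘ f) xs)
ℕtoℚ-sum f []       = refl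
ℕtoℚ-sum f (x ∷ xs) = trans (ℕtoℚ-+ (f x) _) (cong (ℕtoℚ (f x) +ℚ_) (ℕtoℚ-sum f xs))

/-≡-*invℕ : ∀ m n .{{_ : NonZero n}} → + m /ℚ n ≡ ℕtoℚ m *ℚ invℕ n
/-≡-*invℕ m n@(suc _) = sym (trans (/-* (+ m) 1 (+ 1) n)
  (/-≡-cross (+ m *ℤ + 1) (1 * n) (+ m) n
    (trans (cong (_*ℤ + n) (ℤₚ.*-identityʳ (+ m))) (cong (λ k → + m *ℤ + k) (sym (ℕₚ.*-identityˡ n))))))

invℕ-inverseˡ : ∀ n .{{_ : NonZero n}} → invℕ n *ℚ ℕtoℚ n ≡ 1ℚ
invℕ-inverseˡ n@(suc _) = trans (/-* (+ 1) n (+ n) 1)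
  (/-≡-cross (+ 1 *ℤ + n) (n * 1) (+ 1) 1 (begin
    + 1 *ℤ + n *ℤ + 1   ≡⟨ ℤₚ.*-identityʳ _ ⟩
    + 1 *ℤ + n          ≡⟨ ℤₚ.*-identityˡ (+ n) ⟩
    + n                 ≡⟨ cong +_ (ℕₚ.*-identityʳ n) ⟨
    + (n * 1)           ≡⟨ ℤₚ.*-identityˡ _ ⟨
    + 1 *ℤ + (n * 1)    ∎))
  where open ≡-Reasoning

invℕ-* : ∀ m n .{{_ : NonZero m}} .{{_ : NonZero n}} → (invℕ (m * n)) {{ℕₚ.m*n≢0 m n}} ≡ invℕ m *ℚ invℕ n
invℕ-* m n = sym (/-* (+ 1) m (+ 1) n)

ℕtoℚ*invℕ-cross : ∀ a b c d .{{_ : NonZero b}} .{{_ : NonZero d}} →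
  a * d ≡ c * b → ℕtoℚ a *ℚ invℕ b ≡ ℕtoℚ c *ℚ invℕ d
ℕtoℚ*invℕ-cross a b c d eq = begin
  ℕtoℚ a *ℚ invℕ b  ≡⟨ /-≡-*invℕ a b ⟨
  + a /ℚ b          ≡⟨ /-≡-cross (+ a) b (+ c) d (trans (sym (ℤₚ.pos-* a d)) (trans (cong +_ eq) (ℤₚ.pos-* c b))) ⟩
  + c /ℚ d          ≡⟨ /-≡-*invℕ c d ⟩
  ℕtoℚ c *ℚ invℕ d  ∎
  where open ≡-Reasoning

ℕtoℚ*-*invℕ-cancel : ∀ n .{{_ : NonZero n}} x → ℕtoℚ n *ℚ (x *ℚ invℕ n) ≡ x
ℕtoℚ*-*invℕ-cancel n x = begin
  ℕtoℚ n *ℚ (x *ℚ invℕ n)  ≡⟨ solve 3 (λ a x i → a :* (x :* i) := x :* (i :* a)) refl (ℕtoℚ n) x (invℕ n) ⟩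
  x *ℚ (invℕ n *ℚ ℕtoℚ n)  ≡⟨ cong (x *ℚ_) (invℕ-inverseˡ n) ⟩
  x *ℚ 1ℚ                  ≡⟨ ℚₚ.*-identityʳ x ⟩
  x                        ∎
  where
  open ≡-Reasoning
  open ℚSolver.+-*-Solver

invFact-suc : ∀ n → invFact (suc n) ≡ invℕ (suc n) *ℚ invFact n
invFact-suc n = invℕ-* (suc n) (n !) {{_}} {{n ℕₚ.!≢0}}

ℕtoℚ*invFact-suc : ∀ n → ℕtoℚ (suc n) *ℚ invFact (suc n) ≡ invFact n
ℕtoℚ*invFact-suc n = begin
  ℕtoℚ (suc n) *ℚ invFact (suc n)                 ≡⟨ cong (ℕtoℚ (suc n) *ℚ_) (invFact-suc n) ⟩
  ℕtoℚ (suc n) *ℚ (invℕ (suc n) *ℚ invFact n)     ≡⟨ cong (ℕtoℚ (suc n) *ℚ_) (ℚₚ.*-comm (invℕ (suc n)) _) ⟩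
  ℕtoℚ (suc n) *ℚ (invFact n *ℚ invℕ (suc n))     ≡⟨ ℕtoℚ*-*invℕ-cancel (suc n) (invFact n) ⟩
  invFact n                                       ∎
  where open ≡-Reasoning

ℕtoℚ-!*invFact : ∀ n → ℕtoℚ (n !) *ℚ invFact n ≡ 1ℚ
ℕtoℚ-!*invFact n = trans (ℚₚ.*-comm (ℕtoℚ (n !)) _) (invℕ-inverseˡ (n !) {{n ℕₚ.!≢0}})

-- Opaque: letting ∑< unfold while checking the equational chains below is prohibitively expensive.
opaque
  ∑< : ℕ → (ℕ → ℚ) → ℚ
  ∑< zero    f = 0ℚ
  ∑< (suc n) f = f 0 +ℚ ∑< n (f ∘ suc)

  ∑<-zero : ∀ f → ∑< 0 f ≡ 0ℚ
  ∑<-zero f = refl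

  ∑<-suc : ∀ n f → ∑< (suc n) f ≡ f 0 +ℚ ∑< n (f ∘ suc)
  ∑<-suc n f = refl

sumℚ-applyUpTo : ∀ (f : ℕ → ℚ) g n → sumℚ (map f (applyUpTo g n)) ≡ ∑< n (f ∘ g)
sumℚ-applyUpTo f g zero    = sym (∑<-zero _)
sumℚ-applyUpTo f g (suc n) = trans (cong (f (g 0) +ℚ_) (sumℚ-applyUpTo f (g ∘ suc) n)) (sym (∑<-suc n (f ∘ g)))

∑<-cong : ∀ n {f g} → (∀ i → i < n → f i ≡ g i) → ∑< n f ≡ ∑< n g
∑<-cong zero    {f} {g} eq = trans (∑<-zero f) (sym (∑<-zero g))
∑<-cong (suc n) {f} {g} eq = begin
  ∑< (suc n) f              ≡⟨ ∑<-suc n f ⟩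
  f 0 +ℚ ∑< n (f ∘ suc)     ≡⟨ cong₂ _+ℚ_ (eq 0 (s≤s z≤n)) (∑<-cong n (λ i i<n → eq (suc i) (s≤s i<n))) ⟩
  g 0 +ℚ ∑< n (g ∘ suc)     ≡⟨ ∑<-suc n g ⟨
  ∑< (suc n) g              ∎
  where open ≡-Reasoning

∑<-zeros : ∀ n f → (∀ i → i < n → f i ≡ 0ℚ) → ∑< n f ≡ 0ℚ
∑<-zeros n f eq = trans (∑<-cong n eq) (go n)
  where
  go : ∀ n → ∑< n (λ _ → 0ℚ) ≡ 0ℚ
  go zero    = ∑<-zero _
  go (suc n) = trans (∑<-suc n _) (cong (0ℚ +ℚ_) (go n))

∑<-one : ∀ f → ∑< 1 f ≡ f 0
∑<-one f = trans (∑<-suc 0 f) (trans (cong (f 0 +ℚ_) (∑<-zero _)) (ℚₚ.+-identityʳ (f 0)))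

∑<-distrib-+ : ∀ n f g → ∑< n (λ i → f i +ℚ g i) ≡ ∑< n f +ℚ ∑< n g
∑<-distrib-+ zero    f g = trans (∑<-zero _) (sym (cong₂ _+ℚ_ (∑<-zero f) (∑<-zero g)))
∑<-distrib-+ (suc n) f g = begin
  ∑< (suc n) (λ i → f i +ℚ g i)                        ≡⟨ ∑<-suc n _ ⟩
  (f 0 +ℚ g 0) +ℚ ∑< n (λ i → f (suc i) +ℚ g (suc i))  ≡⟨ cong ((f 0 +ℚ g 0) +ℚ_) (∑<-distrib-+ n (f ∘ suc) (g ∘ suc)) ⟩
  (f 0 +ℚ g 0) +ℚ (∑< n (f ∘ suc) +ℚ ∑< n (g ∘ suc))   ≡⟨ solve 4 (λ a b c d → (a :+ b) :+ (c :+ d) := (a :+ c) :+ (b :+ d)) refl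
                                                              (f 0) (g 0) (∑< n (f ∘ suc)) (∑< n (g ∘ suc)) ⟩
  (f 0 +ℚ ∑< n (f ∘ suc)) +ℚ (g 0 +ℚ ∑< n (g ∘ suc))   ≡⟨ cong₂ _+ℚ_ (∑<-suc n f) (∑<-suc n g) ⟨
  ∑< (suc n) f +ℚ ∑< (suc n) g                         ∎
  where
  open ≡-Reasoning
  open ℚSolver.+-*-Solver

∑<-*ˡ : ∀ n a f → ∑< n (λ i → a *ℚ f i) ≡ a *ℚ ∑< n f
∑<-*ˡ zero    a f = trans (∑<-zero _) (sym (trans (cong (a *ℚ_) (∑<-zero f)) (ℚₚ.*-zeroʳ a)))
∑<-*ˡ (suc n) a f = begin
  ∑< (suc n) (λ i → a *ℚ f i)          ≡⟨ ∑<-suc n _ ⟩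
  a *ℚ f 0 +ℚ ∑< n (λ i → a *ℚ f (suc i))  ≡⟨ cong (a *ℚ f 0 +ℚ_) (∑<-*ˡ n a (f ∘ suc)) ⟩
  a *ℚ f 0 +ℚ a *ℚ ∑< n (f ∘ suc)      ≡⟨ ℚₚ.*-distribˡ-+ a (f 0) _ ⟨
  a *ℚ (f 0 +ℚ ∑< n (f ∘ suc))         ≡⟨ cong (a *ℚ_) (∑<-suc n f) ⟨
  a *ℚ ∑< (suc n) f                    ∎
  where open ≡-Reasoning

∑<-*ʳ : ∀ n a f → ∑< n (λ i → f i *ℚ a) ≡ ∑< n f *ℚ a
∑<-*ʳ n a f = trans (∑<-cong n (λ i _ → ℚₚ.*-comm (f i) a)) (trans (∑<-*ˡ n a f) (ℚₚ.*-comm a _))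

∑<-last : ∀ n f → ∑< (suc n) f ≡ ∑< n f +ℚ f n
∑<-last zero    f = trans (∑<-one f) (sym (trans (cong (_+ℚ f 0) (∑<-zero f)) (ℚₚ.+-identityˡ (f 0))))
∑<-last (suc n) f = begin
  ∑< (suc (suc n)) f                        ≡⟨ ∑<-suc (suc n) f ⟩
  f 0 +ℚ ∑< (suc n) (f ∘ suc)               ≡⟨ cong (f 0 +ℚ_) (∑<-last n (f ∘ suc)) ⟩
  f 0 +ℚ (∑< n (f ∘ suc) +ℚ f (suc n))      ≡⟨ ℚₚ.+-assoc (f 0) _ _ ⟨
  (f 0 +ℚ ∑< n (f ∘ suc)) +ℚ f (suc n)      ≡⟨ cong (_+ℚ f (suc n)) (∑<-suc n f) ⟨
  ∑< (suc n) f +ℚ f (suc n)                 ∎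
  where open ≡-Reasoning

∑<-reverse : ∀ n f → ∑< n f ≡ ∑< n (λ i → f (n ∸ suc i))
∑<-reverse zero    f = trans (∑<-zero f) (sym (∑<-zero _))
∑<-reverse (suc n) f = begin
  ∑< (suc n) f                                     ≡⟨ ∑<-suc n f ⟩
  f 0 +ℚ ∑< n (f ∘ suc)                            ≡⟨ cong (f 0 +ℚ_) (∑<-reverse n (f ∘ suc)) ⟩
  f 0 +ℚ ∑< n (λ i → f (suc (n ∸ suc i)))          ≡⟨ cong (f 0 +ℚ_) (∑<-cong n (λ i i<n → cong f (sym (ℕₚ.+-∸-assoc 1 i<n)))) ⟩
  f 0 +ℚ ∑< n (λ i → f (n ∸ i))                    ≡⟨ ℚₚ.+-comm (f 0) _ ⟩
  ∑< n (λ i → f (n ∸ i)) +ℚ f 0                    ≡⟨ cong (λ k → ∑< n (λ i → f (n ∸ i)) +ℚ f k) (ℕₚ.n∸n≡0 n) ⟨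
  ∑< n (λ i → f (n ∸ i)) +ℚ f (n ∸ n)              ≡⟨ ∑<-last n (λ i → f (n ∸ i)) ⟨
  ∑< (suc n) (λ i → f (n ∸ i))                     ∎
  where open ≡-Reasoning

∑<-comm : ∀ n m (g : ℕ → ℕ → ℚ) → ∑< n (λ i → ∑< m (g i)) ≡ ∑< m (λ j → ∑< n (λ i → g i j))
∑<-comm zero    m g = trans (∑<-zero _) (sym (∑<-zeros m _ (λ _ _ → ∑<-zero _)))
∑<-comm (suc n) m g = begin
  ∑< (suc n) (λ i → ∑< m (g i))                              ≡⟨ ∑<-suc n _ ⟩
  ∑< m (g 0) +ℚ ∑< n (λ i → ∑< m (g (suc i)))                ≡⟨ cong (∑< m (g 0) +ℚ_) (∑<-comm n m (g ∘ suc)) ⟩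
  ∑< m (g 0) +ℚ ∑< m (λ j → ∑< n (λ i → g (suc i) j))        ≡⟨ ∑<-distrib-+ m (g 0) _ ⟨
  ∑< m (λ j → g 0 j +ℚ ∑< n (λ i → g (suc i) j))             ≡⟨ ∑<-cong m (λ j _ → sym (∑<-suc n (λ i → g i j))) ⟩
  ∑< m (λ j → ∑< (suc n) (λ i → g i j))                      ∎
  where open ≡-Reasoning

∑<-extend : ∀ m d f → (∀ j → m ≤ j → f j ≡ 0ℚ) → ∑< (m + d) f ≡ ∑< m f
∑<-extend m zero    f eq = cong (λ k → ∑< k f) (ℕₚ.+-identityʳ m)
∑<-extend m (suc d) f eq = begin
  ∑< (m + suc d) f              ≡⟨ cong (λ k → ∑< k f) (ℕₚ.+-suc m d) ⟩
  ∑< (suc (m + d)) f            ≡⟨ ∑<-last (m + d) f ⟩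
  ∑< (m + d) f +ℚ f (m + d)     ≡⟨ cong₂ _+ℚ_ (∑<-extend m d f eq) (eq (m + d) (ℕₚ.m≤m+n m d)) ⟩
  ∑< m f +ℚ 0ℚ                  ≡⟨ ℚₚ.+-identityʳ _ ⟩
  ∑< m f                        ∎
  where open ≡-Reasoning

∑<-triangle : ∀ n (g : ℕ → ℕ → ℚ) →
  ∑< (suc n) (λ i → ∑< (suc i) (g i)) ≡ ∑< (suc n) (λ j → ∑< (suc (n ∸ j)) (λ l → g (j + l) j))
∑<-triangle zero g = begin
  ∑< 1 (λ i → ∑< (suc i) (g i))                  ≡⟨ ∑<-one _ ⟩
  ∑< 1 (g 0)                                     ≡⟨ ∑<-one _ ⟩
  g 0 0                                          ≡⟨ ∑<-one _ ⟨
  ∑< 1 (λ l → g l 0)                             ≡⟨ ∑<-one _ ⟨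
  ∑< 1 (λ j → ∑< (suc (0 ∸ j)) (λ l → g (j + l) j)) ∎
  where open ≡-Reasoning
∑<-triangle (suc n) g = begin
  ∑< (suc (suc n)) (λ i → ∑< (suc i) (g i))                    ≡⟨ ∑<-last (suc n) _ ⟩
  ∑< (suc n) (λ i → ∑< (suc i) (g i)) +ℚ ∑< (suc (suc n)) (g (suc n))
                                                               ≡⟨ cong₂ _+ℚ_ (∑<-triangle n g) (∑<-last (suc n) (g (suc n))) ⟩
  ∑< (suc n) R +ℚ (∑< (suc n) (g (suc n)) +ℚ g (suc n) (suc n)) ≡⟨ ℚₚ.+-assoc (∑< (suc n) R) _ _ ⟨
  (∑< (suc n) R +ℚ ∑< (suc n) (g (suc n))) +ℚ g (suc n) (suc n) ≡⟨ cong₂ _+ℚ_ rows corner ⟩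
  ∑< (suc n) R′ +ℚ R′ (suc n)                                  ≡⟨ ∑<-last (suc n) R′ ⟨
  ∑< (suc (suc n)) R′                                          ∎
  where
  open ≡-Reasoning
  R R′ : ℕ → ℚ
  R  j = ∑< (suc (n ∸ j)) (λ l → g (j + l) j)
  R′ j = ∑< (suc (suc n ∸ j)) (λ l → g (j + l) j)
  row : ∀ j → j < suc n → R j +ℚ g (suc n) j ≡ R′ j
  row j (s≤s j≤n) = sym (begin
    ∑< (suc (suc n ∸ j)) (λ l → g (j + l) j)               ≡⟨ cong (λ k → ∑< (suc k) (λ l → g (j + l) j)) (ℕₚ.+-∸-assoc 1 j≤n) ⟩
    ∑< (suc (suc (n ∸ j))) (λ l → g (j + l) j)             ≡⟨ ∑<-last (suc (n ∸ j)) _ ⟩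
    R j +ℚ g (j + suc (n ∸ j)) j                           ≡⟨ cong (λ k → R j +ℚ g k j) (trans (ℕₚ.+-suc j (n ∸ j)) (cong suc (ℕₚ.m+[n∸m]≡n j≤n))) ⟩
    R j +ℚ g (suc n) j                                     ∎)
  rows : ∑< (suc n) R +ℚ ∑< (suc n) (g (suc n)) ≡ ∑< (suc n) R′
  rows = trans (sym (∑<-distrib-+ (suc n) R (g (suc n)))) (∑<-cong (suc n) row)
  corner : g (suc n) (suc n) ≡ R′ (suc n)
  corner = sym (begin
    ∑< (suc (suc n ∸ suc n)) (λ l → g (suc n + l) (suc n))  ≡⟨ cong (λ k → ∑< (suc k) (λ l → g (suc n + l) (suc n))) (ℕₚ.n∸n≡0 n) ⟩
    ∑< 1 (λ l → g (suc n + l) (suc n))                      ≡⟨ ∑<-one _ ⟩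
    g (suc n + 0) (suc n)                                   ≡⟨ cong (λ k → g k (suc n)) (ℕₚ.+-identityʳ (suc n)) ⟩
    g (suc n) (suc n)                                       ∎)

∑<-evens : ∀ r f → (∀ a → f (suc (2 * a)) ≡ 0ℚ) → ∑< (suc (2 * r)) f ≡ ∑< (suc r) (λ a → f (2 * a))
∑<-evens zero    f odd = trans (∑<-one f) (sym (∑<-one _))
∑<-evens (suc r) f odd = begin
  ∑< (suc (2 * suc r)) f                                 ≡⟨ cong (λ k → ∑< (suc k) f) (ℕₚ.*-suc 2 r) ⟩
  ∑< (suc (suc (suc (2 * r)))) f                         ≡⟨ ∑<-suc _ f ⟩
  f 0 +ℚ ∑< (suc (suc (2 * r))) (f ∘ suc)                ≡⟨ cong (f 0 +ℚ_) (∑<-suc _ (f ∘ suc)) ⟩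
  f 0 +ℚ (f 1 +ℚ ∑< (suc (2 * r)) (f ∘ suc ∘ suc))       ≡⟨ cong (λ x → f 0 +ℚ (x +ℚ ∑< (suc (2 * r)) (f ∘ suc ∘ suc))) (odd 0) ⟩
  f 0 +ℚ (0ℚ +ℚ ∑< (suc (2 * r)) (f ∘ suc ∘ suc))        ≡⟨ cong (f 0 +ℚ_) (ℚₚ.+-identityˡ _) ⟩
  f 0 +ℚ ∑< (suc (2 * r)) (f ∘ suc ∘ suc)                ≡⟨ cong (f 0 +ℚ_) (∑<-evens r (f ∘ suc ∘ suc) odd′) ⟩
  f 0 +ℚ ∑< (suc r) (λ a → f (suc (suc (2 * a))))       ≡⟨ cong (f 0 +ℚ_) (∑<-cong (suc r) (λ a _ → cong f (sym (ℕₚ.*-suc 2 a)))) ⟩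
  f 0 +ℚ ∑< (suc r) (λ a → f (2 * suc a))                ≡⟨ ∑<-suc (suc r) _ ⟨
  ∑< (suc (suc r)) (λ a → f (2 * a))                     ∎
  where
  open ≡-Reasoning
  odd′ : ∀ a → f (suc (suc (suc (2 * a)))) ≡ 0ℚ
  odd′ a = trans (cong (f ∘ suc) (sym (ℕₚ.*-suc 2 a))) (odd (suc a))

-- The coefficients c_k and the closed form of T

nth-++ˡ : ∀ l r i → i < length l → nth (l ++ r) i ≡ nth l i
nth-++ˡ (x ∷ l) r zero    _         = refl
nth-++ˡ (x ∷ l) r (suc i) (s≤s i<l) = nth-++ˡ l r i i<l

nth-++-length : ∀ l x r → nth (l ++ x ∷ r) (length l) ≡ x
nth-++-length []      x r = refl
nth-++-length (y ∷ l) x r = nth-++-length l x r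

length-cs : ∀ k → length (cs k) ≡ k
length-cs zero    = refl
length-cs (suc k) = trans (Listₚ.length-++ (cs k)) (trans (ℕₚ.+-comm (length (cs k)) 1) (cong suc (length-cs k)))

c≡cNext-cs : ∀ k → c k ≡ cNext (cs k)
c≡cNext-cs k = subst (λ i → nth (cs k ++ cNext (cs k) ∷ []) i ≡ cNext (cs k)) (length-cs k) (nth-++-length (cs k) (cNext (cs k)) [])

nth-cs : ∀ k i → i < k → nth (cs k) i ≡ c i
nth-cs (suc k) i (s≤s i≤k) with ℕₚ.m≤n⇒m<n∨m≡n i≤k
... | inj₁ i<k  = trans (nth-++ˡ (cs k) _ i (subst (i <_) (sym (length-cs k)) i<k)) (nth-cs k i i<k)
... | inj₂ refl = refl

c-suc : ∀ k → c (suc k) ≡ ∑< (suc k) (λ m → (c m *ℚ c (k ∸ m)) *ℚ invℕ (suc m * suc (2 * m)))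
c-suc k = begin
  c (suc k)
    ≡⟨ c≡cNext-cs (suc k) ⟩
  cNext (cs (suc k))
    ≡⟨ cNext-∷ (cs k) (cNext (cs k)) ⟩
  sumℚ (map (term (cs (suc k))) (upTo (length (cs (suc k)))))
    ≡⟨ sumℚ-applyUpTo (term (cs (suc k))) (λ i → i) (length (cs (suc k))) ⟩
  ∑< (length (cs (suc k))) (term (cs (suc k)))
    ≡⟨ cong (λ n → ∑< n (term (cs (suc k)))) (length-cs (suc k)) ⟩
  ∑< (suc k) (term (cs (suc k)))
    ≡⟨ ∑<-cong (suc k) (λ m m<1+k → cong₂ (λ u v → (u *ℚ v) *ℚ invℕ (suc m * suc (2 * m)))
                                         (nth-cs (suc k) m m<1+k)
                                         (trans (cong (λ n → nth (cs (suc k)) (n ∸ 1 ∸ m)) (length-cs (suc k)))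
                                                (nth-cs (suc k) (k ∸ m) (s≤s (ℕₚ.m∸n≤m k m))))) ⟩
  ∑< (suc k) (λ m → (c m *ℚ c (k ∸ m)) *ℚ invℕ (suc m * suc (2 * m))) ∎
  where
  open ≡-Reasoning
  term : List ℚ → ℕ → ℚ
  term l m = (nth l m *ℚ nth l (length l ∸ 1 ∸ m)) *ℚ invℕ (suc m * suc (2 * m))
  cNext-∷ : ∀ l x → cNext (l ++ x ∷ []) ≡ sumℚ (map (term (l ++ x ∷ [])) (upTo (length (l ++ x ∷ []))))
  cNext-∷ [] x = refl
  cNext-∷ (_ ∷ _) x = refl

nCk*k!*[n∸k]!≡n! : ∀ n k → k ≤ n → (n C k) * (k ! * (n ∸ k) !) ≡ n !
nCk*k!*[n∸k]!≡n! n k k≤n = trans (cong (_* (k ! * (n ∸ k) !)) (Combinatorics.nCk≡n!/k![n-k]! k≤n))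
  (DivMod.m/n*n≡m {{ℕₚ.m*n≢0 (k !) ((n ∸ k) !) {{k ℕₚ.!≢0}} {{(n ∸ k) ℕₚ.!≢0}}}} (Combinatorics.k![n∸k]!∣n! k≤n))

prefactor : ℕ → ℚ
prefactor m = ℕtoℚ ((2 * m) !) *ℚ inv2^ m

-- For k = m + q + 1: C(2k, 2m+2) (2m)!/2^m (2q)!/2^q = (2k)!/2^k / ((m+1)(2m+1)), denominators cleared.
binomial-prefactor-ℕ : ∀ m q → ((2 * suc (suc (m + q)) ∸ 2) C (2 * suc m)) * (2 * m) ! * (2 * q) ! * (2 ^ suc (m + q) * (suc m * suc (2 * m)))
                              ≡ (2 * suc (m + q)) ! * (2 ^ m * 2 ^ q)
binomial-prefactor-ℕ m q = begin
    binom′ * F₁ * F₂ * (2 ^ suc (m + q) * (suc m * suc (2 * m)))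
  ≡⟨ cong₂ (λ u v → u * F₁ * F₂ * (v * (suc m * suc (2 * m)))) (cong (_C K) N≡) (cong (2 *_) (ℕₚ.^-distribˡ-+-* 2 m q)) ⟩
    binom * F₁ * F₂ * (2 * P * (suc m * suc (2 * m)))
  ≡⟨ solve 5 (λ b f₁ f₂ p m → b :* f₁ :* f₂ :* (con 2 :* p :* ((con 1 :+ m) :* (con 1 :+ con 2 :* m)))
                  := (b :* ((con 2 :+ con 2 :* m) :* ((con 1 :+ con 2 :* m) :* f₁) :* f₂)) :* p) refl binom F₁ F₂ P m ⟩
    binom * ((suc (suc (2 * m))) ! * F₂) * P
  ≡⟨ cong (λ z → binom * z * P) (cong₂ _*_ (cong _! (sym (ℕₚ.*-suc 2 m))) (cong _! (sym N∸K≡))) ⟩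
    binom * (K ! * (N ∸ K) !) * P
  ≡⟨ cong (_* P) (nCk*k!*[n∸k]!≡n! N K K≤N) ⟩
    N ! * P ∎
  where
  open ≡-Reasoning
  open ℕSolver.+-*-Solver
  N = 2 * suc (m + q)
  K = 2 * suc m
  binom′ = (2 * suc (suc (m + q)) ∸ 2) C K
  binom = N C K
  F₁ = (2 * m) !
  F₂ = (2 * q) !
  P = 2 ^ m * 2 ^ q
  N≡ : 2 * suc (suc (m + q)) ∸ 2 ≡ N
  N≡ = cong (_∸ 2) (ℕₚ.*-suc 2 (suc (m + q)))
  K≤N : K ≤ N
  K≤N = ℕₚ.*-monoʳ-≤ 2 (s≤s (ℕₚ.m≤m+n m q))
  N∸K≡ : N ∸ K ≡ 2 * q
  N∸K≡ = trans (cong (_∸ K) (ℕₚ.*-distribˡ-+ 2 (suc m) q)) (ℕₚ.m+n∸m≡n K (2 * q))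

binomial-prefactor : ∀ m q → ℕtoℚ ((2 * suc (suc (m + q)) ∸ 2) C (2 * suc m)) *ℚ prefactor m *ℚ prefactor q
                              ≡ prefactor (suc (m + q)) *ℚ invℕ (suc m * suc (2 * m))
binomial-prefactor m q = begin
    ℕtoℚ binom *ℚ (ℕtoℚ F₁ *ℚ inv2^ m) *ℚ (ℕtoℚ F₂ *ℚ inv2^ q)
  ≡⟨ solve 5 (λ b f₁ f₂ i₁ i₂ → b :* (f₁ :* i₁) :* (f₂ :* i₂) := (b :* f₁ :* f₂) :* (i₁ :* i₂)) refl
       (ℕtoℚ binom) (ℕtoℚ F₁) (ℕtoℚ F₂) (inv2^ m) (inv2^ q) ⟩
    (ℕtoℚ binom *ℚ ℕtoℚ F₁ *ℚ ℕtoℚ F₂) *ℚ (inv2^ m *ℚ inv2^ q)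
  ≡⟨ cong₂ _*ℚ_ (sym (trans (ℕtoℚ-* (binom * F₁) F₂) (cong (_*ℚ ℕtoℚ F₂) (ℕtoℚ-* binom F₁))))
                (sym (invℕ-* (2 ^ m) (2 ^ q) {{2^≢0 m}} {{2^≢0 q}})) ⟩
    ℕtoℚ (binom * F₁ * F₂) *ℚ invℕ (2 ^ m * 2 ^ q) {{P≢0}}
  ≡⟨ ℕtoℚ*invℕ-cross (binom * F₁ * F₂) (2 ^ m * 2 ^ q) ((2 * suc (m + q)) !) D {{P≢0}} {{D≢0}} (binomial-prefactor-ℕ m q) ⟩
    ℕtoℚ ((2 * suc (m + q)) !) *ℚ invℕ D {{D≢0}}
  ≡⟨ cong (ℕtoℚ ((2 * suc (m + q)) !) *ℚ_) (invℕ-* (2 ^ suc (m + q)) (suc m * suc (2 * m)) {{2^≢0 (suc (m + q))}}) ⟩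
    ℕtoℚ ((2 * suc (m + q)) !) *ℚ (inv2^ (suc (m + q)) *ℚ invℕ (suc m * suc (2 * m)))
  ≡⟨ ℚₚ.*-assoc (ℕtoℚ ((2 * suc (m + q)) !)) (inv2^ (suc (m + q))) _ ⟨
    prefactor (suc (m + q)) *ℚ invℕ (suc m * suc (2 * m)) ∎
  where
  open ≡-Reasoning
  open ℚSolver.+-*-Solver
  binom = (2 * suc (suc (m + q)) ∸ 2) C (2 * suc m)
  F₁ = (2 * m) !
  F₂ = (2 * q) !
  D = 2 ^ suc (m + q) * (suc m * suc (2 * m))
  2^≢0 : ∀ n → NonZero (2 ^ n)
  2^≢0 n = ℕₚ.m^n≢0 2 n
  P≢0 : NonZero (2 ^ m * 2 ^ q)
  P≢0 = ℕₚ.m*n≢0 _ _ {{2^≢0 m}} {{2^≢0 q}}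
  D≢0 : NonZero D
  D≢0 = ℕₚ.m*n≢0 _ _ {{2^≢0 (suc (m + q))}}

T-closed-form : ∀ m → ℕtoℚ (T (suc m)) ≡ prefactor m *ℚ c m
T-closed-form m = go m m ℕₚ.≤-refl
  where
  go : ∀ N m → m ≤ N → ℕtoℚ (T (suc m)) ≡ prefactor m *ℚ c m
  go N       zero    _         = refl
  go (suc N) (suc k) (s≤s k≤N) = begin
      ℕtoℚ (T (suc (suc k)))
    ≡⟨ cong ℕtoℚ (T-recurrence (suc (suc k)) (s≤s (s≤s z≤n))) ⟩
      ℕtoℚ (sum (map term (applyUpTo suc (suc k))))
    ≡⟨ ℕtoℚ-sum term (applyUpTo suc (suc k)) ⟩
      sumℚ (map (ℕtoℚ ∘ term) (applyUpTo suc (suc k)))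
    ≡⟨ sumℚ-applyUpTo (ℕtoℚ ∘ term) suc (suc k) ⟩
      ∑< (suc k) (ℕtoℚ ∘ term ∘ suc)
    ≡⟨ ∑<-cong (suc k) (λ i i<1+k → term≡ i (ℕₚ.≤-pred i<1+k)) ⟩
      ∑< (suc k) (λ i → prefactor (suc k) *ℚ ((c i *ℚ c (k ∸ i)) *ℚ invℕ (suc i * suc (2 * i))))
    ≡⟨ ∑<-*ˡ (suc k) (prefactor (suc k)) _ ⟩
      prefactor (suc k) *ℚ ∑< (suc k) (λ i → (c i *ℚ c (k ∸ i)) *ℚ invℕ (suc i * suc (2 * i)))
    ≡⟨ cong (prefactor (suc k) *ℚ_) (c-suc k) ⟨
      prefactor (suc k) *ℚ c (suc k) ∎
    where
    open ≡-Reasoning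
    open ℚSolver.+-*-Solver
    n = suc (suc k)
    term : ℕ → ℕ
    term j = ((2 * n ∸ 2) C (2 * j)) * T j * T (n ∸ j)
    term≡ : ∀ i → i ≤ k → ℕtoℚ (term (suc i)) ≡ prefactor (suc k) *ℚ ((c i *ℚ c (k ∸ i)) *ℚ invℕ (suc i * suc (2 * i)))
    term≡ i i≤k = begin
        ℕtoℚ (binom * T (suc i) * T (suc k ∸ i))
      ≡⟨ cong (λ j → ℕtoℚ (binom * T (suc i) * T j)) (ℕₚ.+-∸-assoc 1 i≤k) ⟩
        ℕtoℚ (binom * T (suc i) * T (suc q))
      ≡⟨ trans (ℕtoℚ-* (binom * T (suc i)) (T (suc q))) (cong (_*ℚ ℕtoℚ (T (suc q))) (ℕtoℚ-* binom (T (suc i)))) ⟩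
        ℕtoℚ binom *ℚ ℕtoℚ (T (suc i)) *ℚ ℕtoℚ (T (suc q))
      ≡⟨ cong₂ (λ u v → ℕtoℚ binom *ℚ u *ℚ v) (go N i (ℕₚ.≤-trans i≤k k≤N)) (go N q (ℕₚ.≤-trans (ℕₚ.m∸n≤m k i) k≤N)) ⟩
        ℕtoℚ binom *ℚ (prefactor i *ℚ c i) *ℚ (prefactor q *ℚ c q)
      ≡⟨ solve 5 (λ b pᵢ p_q cᵢ c_q → b :* (pᵢ :* cᵢ) :* (p_q :* c_q) := (b :* pᵢ :* p_q) :* (cᵢ :* c_q)) refl
           (ℕtoℚ binom) (prefactor i) (prefactor q) (c i) (c q) ⟩
        (ℕtoℚ binom *ℚ prefactor i *ℚ prefactor q) *ℚ (c i *ℚ c q)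
      ≡⟨ cong (_*ℚ (c i *ℚ c q)) (subst (λ s → ℕtoℚ ((2 * suc (suc s) ∸ 2) C (2 * suc i)) *ℚ prefactor i *ℚ prefactor q
                                                ≡ prefactor (suc s) *ℚ invℕ (suc i * suc (2 * i)))
                                         (ℕₚ.m+[n∸m]≡n i≤k) (binomial-prefactor i q)) ⟩
        (prefactor (suc k) *ℚ invℕ (suc i * suc (2 * i))) *ℚ (c i *ℚ c q)
      ≡⟨ solve 3 (λ p d x → (p :* d) :* x := p :* (x :* d)) refl (prefactor (suc k)) (invℕ (suc i * suc (2 * i))) (c i *ℚ c q) ⟩
        prefactor (suc k) *ℚ ((c i *ℚ c q) *ℚ invℕ (suc i * suc (2 * i))) ∎
      where
      q = k ∸ i
      binom = (2 * n ∸ 2) C (2 * suc i)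

-- Formal power series

infix  4 _≐_
infixl 6 _⊕_
infixr 7 _·_

_≐_ : Series → Series → Set
F ≐ G = ∀ n → F n ≡ G n

_⊕_ : Series → Series → Series
(F ⊕ G) n = F n +ℚ G n

_·_ : ℚ → Series → Series
(a · F) n = a *ℚ F n

zeroS : Series
zeroS _ = 0ℚ

∂ : Series → Series
∂ F n = ℕtoℚ (suc n) *ℚ F (suc n)

⊛-as-∑< : ∀ F G n → (F ⊛ G) n ≡ ∑< (suc n) (λ i → F i *ℚ G (n ∸ i))
⊛-as-∑< F G n = sumℚ-applyUpTo (λ i → F i *ℚ G (n ∸ i)) (λ i → i) (suc n)

⊛-cong : ∀ {F F′ G G′} → F ≐ F′ → G ≐ G′ → F ⊛ G ≐ F′ ⊛ G′
⊛-cong {F} {F′} {G} {G′} F≐F′ G≐G′ n = begin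
  (F ⊛ G) n                               ≡⟨ ⊛-as-∑< F G n ⟩
  ∑< (suc n) (λ i → F i *ℚ G (n ∸ i))     ≡⟨ ∑<-cong (suc n) (λ i _ → cong₂ _*ℚ_ (F≐F′ i) (G≐G′ (n ∸ i))) ⟩
  ∑< (suc n) (λ i → F′ i *ℚ G′ (n ∸ i))   ≡⟨ ⊛-as-∑< F′ G′ n ⟨
  (F′ ⊛ G′) n                             ∎
  where open ≡-Reasoning

⊛-congˡ : ∀ {F G} H → F ≐ G → F ⊛ H ≐ G ⊛ H
⊛-congˡ H F≐G = ⊛-cong {G = H} {G′ = H} F≐G (λ _ → refl)

⊛-congʳ : ∀ F {G H} → G ≐ H → F ⊛ G ≐ F ⊛ H
⊛-congʳ F G≐H = ⊛-cong {F} {F} (λ _ → refl) G≐H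

⊛-congʳ-upTo : ∀ F {G H} n → (∀ i → i ≤ n → G i ≡ H i) → (F ⊛ G) n ≡ (F ⊛ H) n
⊛-congʳ-upTo F {G} {H} n G≡H = begin
  (F ⊛ G) n                               ≡⟨ ⊛-as-∑< F G n ⟩
  ∑< (suc n) (λ i → F i *ℚ G (n ∸ i))     ≡⟨ ∑<-cong (suc n) (λ i _ → cong (F i *ℚ_) (G≡H (n ∸ i) (ℕₚ.m∸n≤m n i))) ⟩
  ∑< (suc n) (λ i → F i *ℚ H (n ∸ i))     ≡⟨ ⊛-as-∑< F H n ⟨
  (F ⊛ H) n                               ∎
  where open ≡-Reasoning

⊛-comm : ∀ F G → F ⊛ G ≐ G ⊛ F
⊛-comm F G n = begin
  (F ⊛ G) n                                     ≡⟨ ⊛-as-∑< F G n ⟩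
  ∑< (suc n) (λ i → F i *ℚ G (n ∸ i))           ≡⟨ ∑<-reverse (suc n) _ ⟩
  ∑< (suc n) (λ i → F (n ∸ i) *ℚ G (n ∸ (n ∸ i))) ≡⟨ ∑<-cong (suc n) swap ⟩
  ∑< (suc n) (λ i → G i *ℚ F (n ∸ i))           ≡⟨ ⊛-as-∑< G F n ⟨
  (G ⊛ F) n                                     ∎
  where
  open ≡-Reasoning
  swap : ∀ i → i < suc n → F (n ∸ i) *ℚ G (n ∸ (n ∸ i)) ≡ G i *ℚ F (n ∸ i)
  swap i (s≤s i≤n) = trans (cong (λ k → F (n ∸ i) *ℚ G k) (ℕₚ.m∸[m∸n]≡n i≤n)) (ℚₚ.*-comm (F (n ∸ i)) (G i))

⊛-assoc : ∀ F G H → (F ⊛ G) ⊛ H ≐ F ⊛ (G ⊛ H)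
⊛-assoc F G H n = begin
  ((F ⊛ G) ⊛ H) n
    ≡⟨ ⊛-as-∑< (F ⊛ G) H n ⟩
  ∑< (suc n) (λ i → (F ⊛ G) i *ℚ H (n ∸ i))
    ≡⟨ ∑<-cong (suc n) (λ i _ → trans (cong (_*ℚ H (n ∸ i)) (⊛-as-∑< F G i)) (sym (∑<-*ʳ (suc i) (H (n ∸ i)) _))) ⟩
  ∑< (suc n) (λ i → ∑< (suc i) (λ j → (F j *ℚ G (i ∸ j)) *ℚ H (n ∸ i)))
    ≡⟨ ∑<-triangle n (λ i j → (F j *ℚ G (i ∸ j)) *ℚ H (n ∸ i)) ⟩
  ∑< (suc n) (λ j → ∑< (suc (n ∸ j)) (λ l → (F j *ℚ G (j + l ∸ j)) *ℚ H (n ∸ (j + l))))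
    ≡⟨ ∑<-cong (suc n) (λ j _ → trans (∑<-cong (suc (n ∸ j)) (λ l _ → reindex j l)) (∑<-*ˡ (suc (n ∸ j)) (F j) _)) ⟩
  ∑< (suc n) (λ j → F j *ℚ ∑< (suc (n ∸ j)) (λ l → G l *ℚ H (n ∸ j ∸ l)))
    ≡⟨ ∑<-cong (suc n) (λ j _ → cong (F j *ℚ_) (sym (⊛-as-∑< G H (n ∸ j)))) ⟩
  ∑< (suc n) (λ j → F j *ℚ (G ⊛ H) (n ∸ j))
    ≡⟨ ⊛-as-∑< F (G ⊛ H) n ⟨
  (F ⊛ (G ⊛ H)) n ∎
  where
  open ≡-Reasoning
  reindex : ∀ j l → (F j *ℚ G (j + l ∸ j)) *ℚ H (n ∸ (j + l)) ≡ F j *ℚ (G l *ℚ H (n ∸ j ∸ l))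
  reindex j l = trans (cong₂ (λ a b → (F j *ℚ G a) *ℚ H b) (ℕₚ.m+n∸m≡n j l) (sym (ℕₚ.∸-+-assoc n j l)))
                      (ℚₚ.*-assoc (F j) _ _)

⊛-distribˡ-⊕ : ∀ F G H → F ⊛ (G ⊕ H) ≐ F ⊛ G ⊕ F ⊛ H
⊛-distribˡ-⊕ F G H n = begin
  (F ⊛ (G ⊕ H)) n                                              ≡⟨ ⊛-as-∑< F (G ⊕ H) n ⟩
  ∑< (suc n) (λ i → F i *ℚ (G (n ∸ i) +ℚ H (n ∸ i)))           ≡⟨ ∑<-cong (suc n) (λ i _ → ℚₚ.*-distribˡ-+ (F i) _ _) ⟩
  ∑< (suc n) (λ i → F i *ℚ G (n ∸ i) +ℚ F i *ℚ H (n ∸ i))      ≡⟨ ∑<-distrib-+ (suc n) _ _ ⟩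
  ∑< (suc n) (λ i → F i *ℚ G (n ∸ i)) +ℚ ∑< (suc n) (λ i → F i *ℚ H (n ∸ i))
                                                               ≡⟨ cong₂ _+ℚ_ (⊛-as-∑< F G n) (⊛-as-∑< F H n) ⟨
  (F ⊛ G ⊕ F ⊛ H) n                                            ∎
  where open ≡-Reasoning

⊛-·ʳ : ∀ a F G → F ⊛ (a · G) ≐ a · (F ⊛ G)
⊛-·ʳ a F G n = begin
  (F ⊛ (a · G)) n                              ≡⟨ ⊛-as-∑< F (a · G) n ⟩
  ∑< (suc n) (λ i → F i *ℚ (a *ℚ G (n ∸ i)))   ≡⟨ ∑<-cong (suc n) (λ i _ → solve 3 (λ f g a → f :* (a :* g) := a :* (f :* g)) refl (F i) (G (n ∸ i)) a) ⟩
  ∑< (suc n) (λ i → a *ℚ (F i *ℚ G (n ∸ i)))   ≡⟨ ∑<-*ˡ (suc n) a _ ⟩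
  a *ℚ ∑< (suc n) (λ i → F i *ℚ G (n ∸ i))     ≡⟨ cong (a *ℚ_) (⊛-as-∑< F G n) ⟨
  (a · (F ⊛ G)) n                              ∎
  where
  open ≡-Reasoning
  open ℚSolver.+-*-Solver

⊛-·ˡ : ∀ a F G → (a · F) ⊛ G ≐ a · (F ⊛ G)
⊛-·ˡ a F G n = trans (⊛-comm (a · F) G n) (trans (⊛-·ʳ a G F n) (cong (a *ℚ_) (⊛-comm G F n)))

⊛-identityˡ : ∀ F → oneS ⊛ F ≐ F
⊛-identityˡ F n = begin
  (oneS ⊛ F) n                                           ≡⟨ ⊛-as-∑< oneS F n ⟩
  ∑< (suc n) (λ i → oneS i *ℚ F (n ∸ i))                 ≡⟨ ∑<-suc n _ ⟩
  1ℚ *ℚ F n +ℚ ∑< n (λ i → 0ℚ *ℚ F (n ∸ suc i))          ≡⟨ cong₂ _+ℚ_ (ℚₚ.*-identityˡ (F n)) (∑<-zeros n _ (λ i _ → ℚₚ.*-zeroˡ (F (n ∸ suc i)))) ⟩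
  F n +ℚ 0ℚ                                              ≡⟨ ℚₚ.+-identityʳ (F n) ⟩
  F n                                                    ∎
  where open ≡-Reasoning

⊛-identityʳ : ∀ F → F ⊛ oneS ≐ F
⊛-identityʳ F n = trans (⊛-comm F oneS n) (⊛-identityˡ F n)

⊛-zeroʳ : ∀ F → F ⊛ zeroS ≐ zeroS
⊛-zeroʳ F n = trans (⊛-as-∑< F zeroS n) (∑<-zeros (suc n) _ (λ i _ → ℚₚ.*-zeroʳ (F i)))

∂-oneS : ∂ oneS ≐ zeroS
∂-oneS n = ℚₚ.*-zeroʳ (ℕtoℚ (suc n))

∂-⊛ : ∀ F G → ∂ (F ⊛ G) ≐ ∂ F ⊛ G ⊕ F ⊛ ∂ G
∂-⊛ F G n = begin
  ℕtoℚ (suc n) *ℚ (F ⊛ G) (suc n)                          ≡⟨ cong (ℕtoℚ (suc n) *ℚ_) (⊛-as-∑< F G (suc n)) ⟩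
  ℕtoℚ (suc n) *ℚ ∑< (suc (suc n)) (λ i → F i *ℚ G (suc n ∸ i)) ≡⟨ ∑<-*ˡ (suc (suc n)) (ℕtoℚ (suc n)) _ ⟨
  ∑< (suc (suc n)) (λ i → ℕtoℚ (suc n) *ℚ (F i *ℚ G (suc n ∸ i))) ≡⟨ ∑<-cong (suc (suc n)) leibniz ⟩
  ∑< (suc (suc n)) (λ i → left i +ℚ right i)               ≡⟨ ∑<-distrib-+ (suc (suc n)) left right ⟩
  ∑< (suc (suc n)) left +ℚ ∑< (suc (suc n)) right          ≡⟨ cong₂ _+ℚ_ lefts rights ⟩
  (∂ F ⊛ G ⊕ F ⊛ ∂ G) n                                    ∎
  where
  open ≡-Reasoning
  open ℚSolver.+-*-Solver
  left right : ℕ → ℚ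
  left  i = (ℕtoℚ i *ℚ F i) *ℚ G (suc n ∸ i)
  right i = F i *ℚ (ℕtoℚ (suc n ∸ i) *ℚ G (suc n ∸ i))
  leibniz : ∀ i → i < suc (suc n) → ℕtoℚ (suc n) *ℚ (F i *ℚ G (suc n ∸ i)) ≡ left i +ℚ right i
  leibniz i (s≤s i≤1+n) = trans
    (cong (_*ℚ (F i *ℚ G (suc n ∸ i))) (trans (cong ℕtoℚ (sym (ℕₚ.m+[n∸m]≡n i≤1+n))) (ℕtoℚ-+ i (suc n ∸ i))))
    (solve 4 (λ a b f g → (a :+ b) :* (f :* g) := (a :* f) :* g :+ f :* (b :* g)) refl
             (ℕtoℚ i) (ℕtoℚ (suc n ∸ i)) (F i) (G (suc n ∸ i)))
  lefts : ∑< (suc (suc n)) left ≡ (∂ F ⊛ G) n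
  lefts = begin
    ∑< (suc (suc n)) left              ≡⟨ ∑<-suc (suc n) left ⟩
    left 0 +ℚ ∑< (suc n) (left ∘ suc)  ≡⟨ cong (_+ℚ ∑< (suc n) (left ∘ suc)) (trans (cong (_*ℚ G (suc n)) (ℚₚ.*-zeroˡ (F 0))) (ℚₚ.*-zeroˡ (G (suc n)))) ⟩
    0ℚ +ℚ ∑< (suc n) (left ∘ suc)      ≡⟨ ℚₚ.+-identityˡ _ ⟩
    ∑< (suc n) (left ∘ suc)            ≡⟨ ⊛-as-∑< (∂ F) G n ⟨
    (∂ F ⊛ G) n                        ∎
  rights : ∑< (suc (suc n)) right ≡ (F ⊛ ∂ G) n
  rights = begin
    ∑< (suc (suc n)) right                 ≡⟨ ∑<-last (suc n) right ⟩
    ∑< (suc n) right +ℚ right (suc n)      ≡⟨ cong (∑< (suc n) right +ℚ_) lastZero ⟩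
    ∑< (suc n) right +ℚ 0ℚ                 ≡⟨ ℚₚ.+-identityʳ _ ⟩
    ∑< (suc n) right                       ≡⟨ ∑<-cong (suc n) (λ i i<1+n → cong (λ k → F i *ℚ (ℕtoℚ k *ℚ G k)) (ℕₚ.+-∸-assoc 1 (ℕₚ.≤-pred i<1+n))) ⟩
    ∑< (suc n) (λ i → F i *ℚ ∂ G (n ∸ i))  ≡⟨ ⊛-as-∑< F (∂ G) n ⟨
    (F ⊛ ∂ G) n                            ∎
    where
    lastZero : right (suc n) ≡ 0ℚ
    lastZero = trans (cong (λ k → F (suc n) *ℚ (ℕtoℚ k *ℚ G k)) (ℕₚ.n∸n≡0 (suc n)))
                     (trans (cong (F (suc n) *ℚ_) (ℚₚ.*-zeroˡ (G 0))) (ℚₚ.*-zeroʳ (F (suc n))))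

powS-vanishes : ∀ F → F 0 ≡ 0ℚ → ∀ j n → n < j → powS F j n ≡ 0ℚ
powS-vanishes F F0≡0 (suc j) n (s≤s n≤j) = trans (⊛-as-∑< F (powS F j) n) (∑<-zeros (suc n) _ term)
  where
  term : ∀ i → i < suc n → F i *ℚ powS F j (n ∸ i) ≡ 0ℚ
  term zero    _         = trans (cong (_*ℚ powS F j n) F0≡0) (ℚₚ.*-zeroˡ (powS F j n))
  term (suc i) (s≤s i<n) = trans (cong (F (suc i) *ℚ_) (powS-vanishes F F0≡0 j (n ∸ suc i) n∸1+i<j)) (ℚₚ.*-zeroʳ (F (suc i)))
    where
    n∸1+i<j : n ∸ suc i < j
    n∸1+i<j = ℕₚ.<-≤-trans (ℕₚ.∸-monoʳ-< {n} {suc i} {0} (s≤s z≤n) i<n) n≤j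

∂-powS : ∀ F j → ∂ (powS F (suc j)) ≐ ℕtoℚ (suc j) · (∂ F ⊛ powS F j)
∂-powS F zero n = begin
  ∂ (F ⊛ oneS) n                      ≡⟨ ∂-⊛ F oneS n ⟩
  (∂ F ⊛ oneS) n +ℚ (F ⊛ ∂ oneS) n    ≡⟨ cong ((∂ F ⊛ oneS) n +ℚ_) (trans (⊛-congʳ F ∂-oneS n) (⊛-zeroʳ F n)) ⟩
  (∂ F ⊛ oneS) n +ℚ 0ℚ                ≡⟨ ℚₚ.+-identityʳ _ ⟩
  (∂ F ⊛ oneS) n                      ≡⟨ ℚₚ.*-identityˡ _ ⟨
  1ℚ *ℚ (∂ F ⊛ oneS) n                ∎
  where open ≡-Reasoning
∂-powS F (suc j) n = begin
  ∂ (F ⊛ Fʲ⁺¹) n                                     ≡⟨ ∂-⊛ F Fʲ⁺¹ n ⟩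
  X +ℚ (F ⊛ ∂ Fʲ⁺¹) n                                ≡⟨ cong (X +ℚ_) (⊛-congʳ F (∂-powS F j) n) ⟩
  X +ℚ (F ⊛ (ℕtoℚ (suc j) · (∂ F ⊛ Fʲ))) n           ≡⟨ cong (X +ℚ_) (⊛-·ʳ (ℕtoℚ (suc j)) F (∂ F ⊛ Fʲ) n) ⟩
  X +ℚ ℕtoℚ (suc j) *ℚ (F ⊛ (∂ F ⊛ Fʲ)) n            ≡⟨ cong (λ y → X +ℚ ℕtoℚ (suc j) *ℚ y) rotate ⟩
  X +ℚ ℕtoℚ (suc j) *ℚ X                             ≡⟨ solve 2 (λ x a → x :+ a :* x := (con 1ℚ :+ a) :* x) refl X (ℕtoℚ (suc j)) ⟩
  (1ℚ +ℚ ℕtoℚ (suc j)) *ℚ X                          ≡⟨ cong (_*ℚ X) (ℕtoℚ-+ 1 (suc j)) ⟨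
  ℕtoℚ (suc (suc j)) *ℚ X                            ∎
  where
  open ≡-Reasoning
  open ℚSolver.+-*-Solver
  Fʲ Fʲ⁺¹ : Series
  Fʲ   = powS F j
  Fʲ⁺¹ = powS F (suc j)
  X = (∂ F ⊛ Fʲ⁺¹) n
  rotate : (F ⊛ (∂ F ⊛ Fʲ)) n ≡ X
  rotate = trans (sym (⊛-assoc F (∂ F) Fʲ n))
                 (trans (⊛-congˡ Fʲ (⊛-comm F (∂ F)) n) (⊛-assoc (∂ F) F Fʲ n))

expS-as-∑< : ∀ F n → expS F n ≡ ∑< (suc n) (λ j → powS F j n *ℚ invFact j)
expS-as-∑< F n = sumℚ-applyUpTo (λ j → powS F j n *ℚ invFact j) (λ i → i) (suc n)

-- The truncation of exp F at j ≤ n is harmless only because F has no constant term.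
∂-expS : ∀ F → F 0 ≡ 0ℚ → ∂ (expS F) ≐ ∂ F ⊛ expS F
∂-expS F F0≡0 n = begin
  ℕtoℚ (suc n) *ℚ expS F (suc n)
    ≡⟨ cong (ℕtoℚ (suc n) *ℚ_) (expS-as-∑< F (suc n)) ⟩
  ℕtoℚ (suc n) *ℚ ∑< (suc (suc n)) (λ j → powS F j (suc n) *ℚ invFact j)
    ≡⟨ ∑<-*ˡ (suc (suc n)) (ℕtoℚ (suc n)) _ ⟨
  ∑< (suc (suc n)) (λ j → ℕtoℚ (suc n) *ℚ (powS F j (suc n) *ℚ invFact j))
    ≡⟨ ∑<-suc (suc n) _ ⟩
  ℕtoℚ (suc n) *ℚ (powS F 0 (suc n) *ℚ invFact 0) +ℚ ∑< (suc n) (λ j → ℕtoℚ (suc n) *ℚ (powS F (suc j) (suc n) *ℚ invFact (suc j)))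
    ≡⟨ cong₂ _+ℚ_ (trans (cong (ℕtoℚ (suc n) *ℚ_) (ℚₚ.*-zeroˡ (invFact 0))) (ℚₚ.*-zeroʳ (ℕtoℚ (suc n))))
                  (∑<-cong (suc n) (λ j _ → powerTerm j)) ⟩
  0ℚ +ℚ ∑< (suc n) (λ j → ∑< (suc n) (λ i → ∂ F i *ℚ (powS F j (n ∸ i) *ℚ invFact j)))
    ≡⟨ ℚₚ.+-identityˡ _ ⟩
  ∑< (suc n) (λ j → ∑< (suc n) (λ i → ∂ F i *ℚ (powS F j (n ∸ i) *ℚ invFact j)))
    ≡⟨ ∑<-comm (suc n) (suc n) (λ j i → ∂ F i *ℚ (powS F j (n ∸ i) *ℚ invFact j)) ⟩
  ∑< (suc n) (λ i → ∑< (suc n) (λ j → ∂ F i *ℚ (powS F j (n ∸ i) *ℚ invFact j)))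
    ≡⟨ ∑<-cong (suc n) expTerm ⟩
  ∑< (suc n) (λ i → ∂ F i *ℚ expS F (n ∸ i))
    ≡⟨ ⊛-as-∑< (∂ F) (expS F) n ⟨
  (∂ F ⊛ expS F) n ∎
  where
  open ≡-Reasoning
  open ℚSolver.+-*-Solver
  powerTerm : ∀ j → ℕtoℚ (suc n) *ℚ (powS F (suc j) (suc n) *ℚ invFact (suc j))
                  ≡ ∑< (suc n) (λ i → ∂ F i *ℚ (powS F j (n ∸ i) *ℚ invFact j))
  powerTerm j = begin
    ℕtoℚ (suc n) *ℚ (powS F (suc j) (suc n) *ℚ invFact (suc j))
      ≡⟨ ℚₚ.*-assoc (ℕtoℚ (suc n)) _ _ ⟨
    ∂ (powS F (suc j)) n *ℚ invFact (suc j)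
      ≡⟨ cong (_*ℚ invFact (suc j)) (∂-powS F j n) ⟩
    (ℕtoℚ (suc j) *ℚ (∂ F ⊛ powS F j) n) *ℚ invFact (suc j)
      ≡⟨ solve 3 (λ a x b → (a :* x) :* b := x :* (a :* b)) refl (ℕtoℚ (suc j)) ((∂ F ⊛ powS F j) n) (invFact (suc j)) ⟩
    (∂ F ⊛ powS F j) n *ℚ (ℕtoℚ (suc j) *ℚ invFact (suc j))
      ≡⟨ cong ((∂ F ⊛ powS F j) n *ℚ_) (ℕtoℚ*invFact-suc j) ⟩
    (∂ F ⊛ powS F j) n *ℚ invFact j
      ≡⟨ cong (_*ℚ invFact j) (⊛-as-∑< (∂ F) (powS F j) n) ⟩
    ∑< (suc n) (λ i → ∂ F i *ℚ powS F j (n ∸ i)) *ℚ invFact j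
      ≡⟨ ∑<-*ʳ (suc n) (invFact j) _ ⟨
    ∑< (suc n) (λ i → (∂ F i *ℚ powS F j (n ∸ i)) *ℚ invFact j)
      ≡⟨ ∑<-cong (suc n) (λ i _ → ℚₚ.*-assoc (∂ F i) _ _) ⟩
    ∑< (suc n) (λ i → ∂ F i *ℚ (powS F j (n ∸ i) *ℚ invFact j)) ∎
  expTerm : ∀ i → i < suc n → ∑< (suc n) (λ j → ∂ F i *ℚ (powS F j (n ∸ i) *ℚ invFact j)) ≡ ∂ F i *ℚ expS F (n ∸ i)
  expTerm i (s≤s i≤n) = begin
    ∑< (suc n) (λ j → ∂ F i *ℚ (powS F j (n ∸ i) *ℚ invFact j))
      ≡⟨ ∑<-*ˡ (suc n) (∂ F i) _ ⟩
    ∂ F i *ℚ ∑< (suc n) (λ j → powS F j (n ∸ i) *ℚ invFact j)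
      ≡⟨ cong (λ k → ∂ F i *ℚ ∑< (suc k) (λ j → powS F j (n ∸ i) *ℚ invFact j)) (ℕₚ.m∸n+n≡m i≤n) ⟨
    ∂ F i *ℚ ∑< (suc (n ∸ i) + i) (λ j → powS F j (n ∸ i) *ℚ invFact j)
      ≡⟨ cong (∂ F i *ℚ_) (∑<-extend (suc (n ∸ i)) i _ (λ j n∸i<j →
           trans (cong (_*ℚ invFact j) (powS-vanishes F F0≡0 j (n ∸ i) n∸i<j)) (ℚₚ.*-zeroˡ (invFact j)))) ⟩
    ∂ F i *ℚ ∑< (suc (n ∸ i)) (λ j → powS F j (n ∸ i) *ℚ invFact j)
      ≡⟨ cong (∂ F i *ℚ_) (expS-as-∑< F (n ∸ i)) ⟨
    ∂ F i *ℚ expS F (n ∸ i) ∎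

coeff-suc-via-∂ : ∀ F n → F (suc n) ≡ invℕ (suc n) *ℚ ∂ F n
coeff-suc-via-∂ F n = begin
  F (suc n)                                    ≡⟨ ℚₚ.*-identityˡ _ ⟨
  1ℚ *ℚ F (suc n)                              ≡⟨ cong (_*ℚ F (suc n)) (invℕ-inverseˡ (suc n)) ⟨
  (invℕ (suc n) *ℚ ℕtoℚ (suc n)) *ℚ F (suc n)  ≡⟨ ℚₚ.*-assoc (invℕ (suc n)) _ _ ⟩
  invℕ (suc n) *ℚ ∂ F n                        ∎
  where open ≡-Reasoning

-- The equation ∂E = K ⊛ E determines E (suc n) from E 0, …, E n.
linear-ode-unique : ∀ K E Y → E 0 ≡ Y 0 → ∂ E ≐ K ⊛ E → ∂ Y ≐ K ⊛ Y → E ≐ Y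
linear-ode-unique K E Y E0≡Y0 odeE odeY n = go n n ℕₚ.≤-refl
  where
  open ≡-Reasoning
  go : ∀ N m → m ≤ N → E m ≡ Y m
  go N       zero    _         = E0≡Y0
  go (suc N) (suc m) (s≤s m≤N) = begin
    E (suc m)                                     ≡⟨ coeff-suc-via-∂ E m ⟩
    invℕ (suc m) *ℚ ∂ E m                         ≡⟨ cong (invℕ (suc m) *ℚ_) (odeE m) ⟩
    invℕ (suc m) *ℚ (K ⊛ E) m                     ≡⟨ cong (invℕ (suc m) *ℚ_) (⊛-congʳ-upTo K m (λ i i≤m → go N i (ℕₚ.≤-trans i≤m m≤N))) ⟩
    invℕ (suc m) *ℚ (K ⊛ Y) m                     ≡⟨ cong (invℕ (suc m) *ℚ_) (odeY m) ⟨
    invℕ (suc m) *ℚ ∂ Y m                         ≡⟨ coeff-suc-via-∂ Y m ⟨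
    Y (suc m)                                     ∎

-- The generating function of T

data Parity : ℕ → Set where
  even : ∀ k → Parity (2 * k)
  odd  : ∀ k → Parity (suc (2 * k))

parity : ∀ n → Parity n
parity zero    = even 0
parity (suc n) with parity n
... | even k = odd k
... | odd  k = subst Parity (ℕₚ.*-suc 2 k) (even (suc k))

evenS-even : ∀ a k → evenS a (2 * k) ≡ a k
evenS-even a zero    = refl
evenS-even a (suc k) = trans (cong (evenS a) (ℕₚ.*-suc 2 k)) (evenS-even (a ∘ suc) k)

evenS-odd : ∀ a k → evenS a (suc (2 * k)) ≡ 0ℚ
evenS-odd a zero    = refl
evenS-odd a (suc k) = trans (cong (evenS a ∘ suc) (ℕₚ.*-suc 2 k)) (evenS-odd (a ∘ suc) k)

oddS-odd : ∀ a k → oddS a (suc (2 * k)) ≡ a k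
oddS-odd a zero    = refl
oddS-odd a (suc k) = trans (cong (oddS a ∘ suc) (ℕₚ.*-suc 2 k)) (oddS-odd (a ∘ suc) k)

oddS-even : ∀ a k → oddS a (2 * k) ≡ 0ℚ
oddS-even a zero    = refl
oddS-even a (suc k) = trans (cong (oddS a) (ℕₚ.*-suc 2 k)) (oddS-even (a ∘ suc) k)

nCk*invFact : ∀ n k → k ≤ n → ℕtoℚ (n C k) *ℚ invFact n ≡ invFact k *ℚ invFact (n ∸ k)
nCk*invFact n k k≤n = begin
  ℕtoℚ (n C k) *ℚ invFact n                   ≡⟨ ℕtoℚ*invℕ-cross (n C k) (n !) 1 (k ! * (n ∸ k) !) {{n ℕₚ.!≢0}} {{k![n∸k]!≢0}}
                                                   (trans (nCk*k!*[n∸k]!≡n! n k k≤n) (sym (ℕₚ.*-identityˡ (n !)))) ⟩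
  1ℚ *ℚ invℕ (k ! * (n ∸ k) !) {{k![n∸k]!≢0}}  ≡⟨ ℚₚ.*-identityˡ _ ⟩
  invℕ (k ! * (n ∸ k) !) {{k![n∸k]!≢0}}        ≡⟨ invℕ-* (k !) ((n ∸ k) !) {{k ℕₚ.!≢0}} {{(n ∸ k) ℕₚ.!≢0}} ⟩
  invFact k *ℚ invFact (n ∸ k)                 ∎
  where
  open ≡-Reasoning
  k![n∸k]!≢0 : NonZero (k ! * (n ∸ k) !)
  k![n∸k]!≢0 = ℕₚ.m*n≢0 _ _ {{k ℕₚ.!≢0}} {{(n ∸ k) ℕₚ.!≢0}}

T-over-factorial : ∀ k → ℕtoℚ (T (suc k)) *ℚ invFact (2 * k) ≡ c k *ℚ inv2^ k
T-over-factorial k = begin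
  ℕtoℚ (T (suc k)) *ℚ invFact (2 * k)                       ≡⟨ cong (_*ℚ invFact (2 * k)) (T-closed-form k) ⟩
  (ℕtoℚ ((2 * k) !) *ℚ inv2^ k *ℚ c k) *ℚ invFact (2 * k)   ≡⟨ solve 4 (λ f i x j → (f :* i :* x) :* j := (x :* i) :* (f :* j)) refl
                                                                  (ℕtoℚ ((2 * k) !)) (inv2^ k) (c k) (invFact (2 * k)) ⟩
  (c k *ℚ inv2^ k) *ℚ (ℕtoℚ ((2 * k) !) *ℚ invFact (2 * k)) ≡⟨ cong ((c k *ℚ inv2^ k) *ℚ_) (ℕtoℚ-!*invFact (2 * k)) ⟩
  (c k *ℚ inv2^ k) *ℚ 1ℚ                                    ≡⟨ ℚₚ.*-identityʳ _ ⟩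
  c k *ℚ inv2^ k                                            ∎
  where
  open ≡-Reasoning
  open ℚSolver.+-*-Solver

Tser-even : ∀ k → Tser T (2 * suc k) ≡ ℕtoℚ (T (suc k)) *ℚ invFact (2 * suc k)
Tser-even k = evenS-even _ (suc k)

Tser-odd : ∀ k → Tser T (suc (2 * k)) ≡ 0ℚ
Tser-odd k = evenS-odd _ k

Vser-odd : ∀ k → Vser (suc (2 * k)) ≡ c k *ℚ (invℕ (suc (2 * k)) *ℚ inv2^ k)
Vser-odd k = oddS-odd _ k

Vser-even : ∀ k → Vser (2 * k) ≡ 0ℚ
Vser-even k = oddS-even _ k

∂Vser-even : ∀ k → ∂ Vser (2 * k) ≡ ℕtoℚ (T (suc k)) *ℚ invFact (2 * k)
∂Vser-even k = begin
  ℕtoℚ (suc (2 * k)) *ℚ Vser (suc (2 * k))                          ≡⟨ cong (ℕtoℚ (suc (2 * k)) *ℚ_) (Vser-odd k) ⟩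
  ℕtoℚ (suc (2 * k)) *ℚ (c k *ℚ (invℕ (suc (2 * k)) *ℚ inv2^ k))    ≡⟨ cong (ℕtoℚ (suc (2 * k)) *ℚ_)
                                                                         (solve 3 (λ x i j → x :* (i :* j) := (x :* j) :* i) refl (c k) (invℕ (suc (2 * k))) (inv2^ k)) ⟩
  ℕtoℚ (suc (2 * k)) *ℚ ((c k *ℚ inv2^ k) *ℚ invℕ (suc (2 * k)))    ≡⟨ ℕtoℚ*-*invℕ-cancel (suc (2 * k)) (c k *ℚ inv2^ k) ⟩
  c k *ℚ inv2^ k                                                    ≡⟨ T-over-factorial k ⟨
  ℕtoℚ (T (suc k)) *ℚ invFact (2 * k)                               ∎
  where
  open ≡-Reasoning
  open ℚSolver.+-*-Solver

∂Vser-odd : ∀ k → ∂ Vser (suc (2 * k)) ≡ 0ℚ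
∂Vser-odd k = begin
  ℕtoℚ (2 + 2 * k) *ℚ Vser (2 + 2 * k)     ≡⟨ cong (λ n → ℕtoℚ (2 + 2 * k) *ℚ Vser n) (ℕₚ.*-suc 2 k) ⟨
  ℕtoℚ (2 + 2 * k) *ℚ Vser (2 * suc k)     ≡⟨ cong (ℕtoℚ (2 + 2 * k) *ℚ_) (Vser-even (suc k)) ⟩
  ℕtoℚ (2 + 2 * k) *ℚ 0ℚ                   ≡⟨ ℚₚ.*-zeroʳ (ℕtoℚ (2 + 2 * k)) ⟩
  0ℚ                                       ∎
  where open ≡-Reasoning

∂Tser≐Vser : ∂ (Tser T) ≐ Vser
∂Tser≐Vser n with parity n
... | even k = begin
  ℕtoℚ (suc (2 * k)) *ℚ Tser T (suc (2 * k))   ≡⟨ cong (ℕtoℚ (suc (2 * k)) *ℚ_) (Tser-odd k) ⟩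
  ℕtoℚ (suc (2 * k)) *ℚ 0ℚ                     ≡⟨ ℚₚ.*-zeroʳ (ℕtoℚ (suc (2 * k))) ⟩
  0ℚ                                           ≡⟨ Vser-even k ⟨
  Vser (2 * k)                                 ∎
  where open ≡-Reasoning
... | odd k = begin
  ℕtoℚ (2 + 2 * k) *ℚ Tser T (2 + 2 * k)
    ≡⟨ cong (λ n → ℕtoℚ (2 + 2 * k) *ℚ Tser T n) (ℕₚ.*-suc 2 k) ⟨
  ℕtoℚ (2 + 2 * k) *ℚ Tser T (2 * suc k)
    ≡⟨ cong (ℕtoℚ (2 + 2 * k) *ℚ_) (trans (Tser-even k) (cong (λ n → ℕtoℚ (T (suc k)) *ℚ invFact n) (ℕₚ.*-suc 2 k))) ⟩
  ℕtoℚ (2 + 2 * k) *ℚ (ℕtoℚ (T (suc k)) *ℚ invFact (2 + 2 * k))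
    ≡⟨ solve 3 (λ a t f → a :* (t :* f) := t :* (a :* f)) refl (ℕtoℚ (2 + 2 * k)) (ℕtoℚ (T (suc k))) (invFact (2 + 2 * k)) ⟩
  ℕtoℚ (T (suc k)) *ℚ (ℕtoℚ (2 + 2 * k) *ℚ invFact (2 + 2 * k))
    ≡⟨ cong (ℕtoℚ (T (suc k)) *ℚ_) (trans (ℕtoℚ*invFact-suc (suc (2 * k))) (invFact-suc (2 * k))) ⟩
  ℕtoℚ (T (suc k)) *ℚ (invℕ (suc (2 * k)) *ℚ invFact (2 * k))
    ≡⟨ solve 3 (λ t i f → t :* (i :* f) := (t :* f) :* i) refl (ℕtoℚ (T (suc k))) (invℕ (suc (2 * k))) (invFact (2 * k)) ⟩
  (ℕtoℚ (T (suc k)) *ℚ invFact (2 * k)) *ℚ invℕ (suc (2 * k))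
    ≡⟨ cong (_*ℚ invℕ (suc (2 * k))) (T-over-factorial k) ⟩
  (c k *ℚ inv2^ k) *ℚ invℕ (suc (2 * k))
    ≡⟨ solve 3 (λ x j i → (x :* j) :* i := x :* (i :* j)) refl (c k) (inv2^ k) (invℕ (suc (2 * k))) ⟩
  c k *ℚ (invℕ (suc (2 * k)) *ℚ inv2^ k)
    ≡⟨ Vser-odd k ⟨
  Vser (suc (2 * k)) ∎
  where
  open ≡-Reasoning
  open ℚSolver.+-*-Solver

Tser≐integS-Vser : Tser T ≐ integS Vser
Tser≐integS-Vser zero    = refl
Tser≐integS-Vser (suc n) = begin
  Tser T (suc n)                  ≡⟨ coeff-suc-via-∂ (Tser T) n ⟩
  invℕ (suc n) *ℚ ∂ (Tser T) n    ≡⟨ cong (invℕ (suc n) *ℚ_) (∂Tser≐Vser n) ⟩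
  invℕ (suc n) *ℚ Vser n          ≡⟨ ℚₚ.*-comm (invℕ (suc n)) (Vser n) ⟩
  integS Vser (suc n)             ∎
  where open ≡-Reasoning

-- The recurrence for T, read on the coefficients of z^(2s+2).
recurrence-as-convolution : ∀ s → ∑< (suc s) (λ a → Tser T (2 * suc a) *ℚ ∂ Vser (2 * (s ∸ a))) ≡ ∂ Vser (2 * suc s)
recurrence-as-convolution s = begin
    ∑< (suc s) (λ a → Tser T (2 * suc a) *ℚ ∂ Vser (2 * (s ∸ a)))
  ≡⟨ ∑<-cong (suc s) (λ a a<1+s → product a (ℕₚ.≤-pred a<1+s)) ⟩
    ∑< (suc s) (λ a → ℕtoℚ (term (suc a)) *ℚ invFact (2 * suc s))
  ≡⟨ ∑<-*ʳ (suc s) (invFact (2 * suc s)) (ℕtoℚ ∘ term ∘ suc) ⟩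
    ∑< (suc s) (ℕtoℚ ∘ term ∘ suc) *ℚ invFact (2 * suc s)
  ≡⟨ cong (_*ℚ invFact (2 * suc s)) (trans (ℕtoℚ-sum term (applyUpTo suc (suc s))) (sumℚ-applyUpTo (ℕtoℚ ∘ term) suc (suc s))) ⟨
    ℕtoℚ (sum (map term (applyUpTo suc (suc s)))) *ℚ invFact (2 * suc s)
  ≡⟨ cong (λ x → ℕtoℚ x *ℚ invFact (2 * suc s)) (T-recurrence (suc (suc s)) (s≤s (s≤s z≤n))) ⟨
    ℕtoℚ (T (suc (suc s))) *ℚ invFact (2 * suc s)
  ≡⟨ ∂Vser-even (suc s) ⟨
    ∂ Vser (2 * suc s) ∎
  where
  open ≡-Reasoning
  open ℚSolver.+-*-Solver
  term : ℕ → ℕ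
  term k = ((2 * suc (suc s) ∸ 2) C (2 * k)) * T k * T (suc (suc s) ∸ k)
  product : ∀ a → a ≤ s → Tser T (2 * suc a) *ℚ ∂ Vser (2 * (s ∸ a)) ≡ ℕtoℚ (term (suc a)) *ℚ invFact (2 * suc s)
  product a a≤s = begin
      Tser T (2 * suc a) *ℚ ∂ Vser (2 * (s ∸ a))
    ≡⟨ cong₂ _*ℚ_ (Tser-even a) (∂Vser-even (s ∸ a)) ⟩
      (Tₐ *ℚ invFact (2 * suc a)) *ℚ (T′ *ℚ invFact (2 * (s ∸ a)))
    ≡⟨ solve 4 (λ t i t′ i′ → (t :* i) :* (t′ :* i′) := (i :* i′) :* t :* t′) refl Tₐ (invFact (2 * suc a)) T′ (invFact (2 * (s ∸ a))) ⟩
      (invFact (2 * suc a) *ℚ invFact (2 * (s ∸ a))) *ℚ Tₐ *ℚ T′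
    ≡⟨ cong (λ x → x *ℚ Tₐ *ℚ T′) (trans (cong (λ n → invFact (2 * suc a) *ℚ invFact n) N∸K≡) (sym (nCk*invFact N K K≤N))) ⟩
      (ℕtoℚ (N C K) *ℚ invFact N) *ℚ Tₐ *ℚ T′
    ≡⟨ solve 4 (λ b i t t′ → (b :* i) :* t :* t′ := (b :* t :* t′) :* i) refl (ℕtoℚ (N C K)) (invFact N) Tₐ T′ ⟩
      (ℕtoℚ (N C K) *ℚ Tₐ *ℚ T′) *ℚ invFact N
    ≡⟨ cong (_*ℚ invFact N) (trans (cong (λ n → ℕtoℚ (n C K) *ℚ Tₐ *ℚ T′) (sym N≡))
                                    (sym (trans (ℕtoℚ-* (binom * T (suc a)) _) (cong (_*ℚ T′) (ℕtoℚ-* binom (T (suc a))))))) ⟩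
      ℕtoℚ (binom * T (suc a) * T (suc (s ∸ a))) *ℚ invFact N
    ≡⟨ cong (λ j → ℕtoℚ (binom * T (suc a) * T j) *ℚ invFact N) (ℕₚ.+-∸-assoc 1 a≤s) ⟨
      ℕtoℚ (term (suc a)) *ℚ invFact N ∎
    where
    N = 2 * suc s
    K = 2 * suc a
    binom = (2 * suc (suc s) ∸ 2) C K
    Tₐ = ℕtoℚ (T (suc a))
    T′ = ℕtoℚ (T (suc (s ∸ a)))
    N≡ : 2 * suc (suc s) ∸ 2 ≡ N
    N≡ = cong (_∸ 2) (ℕₚ.*-suc 2 (suc s))
    K≤N : K ≤ N
    K≤N = ℕₚ.*-monoʳ-≤ 2 (s≤s a≤s)
    N∸K≡ : 2 * (s ∸ a) ≡ N ∸ K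
    N∸K≡ = ℕₚ.*-distribˡ-∸ 2 (suc s) (suc a)

Tser⊛∂Vser : ∀ n → (Tser T ⊛ ∂ Vser) n ≡ ∂ Vser n -ℚ oneS n
Tser⊛∂Vser n with parity n
... | odd r = begin
  (Tser T ⊛ ∂ Vser) (suc (2 * r))   ≡⟨ ⊛-as-∑< (Tser T) (∂ Vser) (suc (2 * r)) ⟩
  ∑< (suc (suc (2 * r))) _           ≡⟨ ∑<-zeros (suc (suc (2 * r))) _ vanishing ⟩
  0ℚ                                ≡⟨ cong (_-ℚ 0ℚ) (∂Vser-odd r) ⟨
  ∂ Vser (suc (2 * r)) -ℚ 0ℚ        ∎
  where
  open ≡-Reasoning
  vanishing : ∀ i → i < suc (suc (2 * r)) → Tser T i *ℚ ∂ Vser (suc (2 * r) ∸ i) ≡ 0ℚ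
  vanishing i i<n with parity i
  ... | odd a  = trans (cong (_*ℚ ∂ Vser (suc (2 * r) ∸ suc (2 * a))) (Tser-odd a)) (ℚₚ.*-zeroˡ (∂ Vser (suc (2 * r) ∸ suc (2 * a))))
  ... | even a = trans (cong (Tser T (2 * a) *ℚ_) (trans (cong (∂ Vser) n∸i≡) (∂Vser-odd (r ∸ a)))) (ℚₚ.*-zeroʳ (Tser T (2 * a)))
    where
    a≤r : a ≤ r
    a≤r = ℕₚ.≤-pred (ℕₚ.*-cancelˡ-< 2 a (suc r) (subst (2 * a <_) (sym (ℕₚ.*-suc 2 r)) i<n))
    n∸i≡ : suc (2 * r) ∸ 2 * a ≡ suc (2 * (r ∸ a))
    n∸i≡ = trans (ℕₚ.+-∸-assoc 1 (ℕₚ.*-monoʳ-≤ 2 a≤r)) (cong suc (sym (ℕₚ.*-distribˡ-∸ 2 r a)))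
... | even r = begin
  (Tser T ⊛ ∂ Vser) (2 * r)                               ≡⟨ ⊛-as-∑< (Tser T) (∂ Vser) (2 * r) ⟩
  ∑< (suc (2 * r)) (λ i → Tser T i *ℚ ∂ Vser (2 * r ∸ i)) ≡⟨ ∑<-evens r _ (λ a → trans (cong (_*ℚ ∂ Vser (2 * r ∸ suc (2 * a))) (Tser-odd a)) (ℚₚ.*-zeroˡ (∂ Vser (2 * r ∸ suc (2 * a))))) ⟩
  ∑< (suc r) (λ a → Tser T (2 * a) *ℚ ∂ Vser (2 * r ∸ 2 * a))
                                                          ≡⟨ ∑<-cong (suc r) (λ a _ → cong (λ j → Tser T (2 * a) *ℚ ∂ Vser j) (sym (ℕₚ.*-distribˡ-∸ 2 r a))) ⟩
  ∑< (suc r) (λ a → Tser T (2 * a) *ℚ ∂ Vser (2 * (r ∸ a))) ≡⟨ even-case r ⟩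
  ∂ Vser (2 * r) -ℚ oneS (2 * r)                          ∎
  where
  open ≡-Reasoning
  even-case : ∀ r → ∑< (suc r) (λ a → Tser T (2 * a) *ℚ ∂ Vser (2 * (r ∸ a))) ≡ ∂ Vser (2 * r) -ℚ oneS (2 * r)
  even-case zero    = trans (∑<-one _) (trans (ℚₚ.*-zeroˡ (∂ Vser 0)) (sym (cong (_-ℚ 1ℚ) (∂Vser-even 0))))
  even-case (suc s) = begin
    ∑< (suc (suc s)) g                      ≡⟨ ∑<-suc (suc s) g ⟩
    g 0 +ℚ ∑< (suc s) (g ∘ suc)             ≡⟨ cong (_+ℚ ∑< (suc s) (g ∘ suc)) (ℚₚ.*-zeroˡ (∂ Vser (2 * suc s))) ⟩
    0ℚ +ℚ ∑< (suc s) (g ∘ suc)              ≡⟨ ℚₚ.+-identityˡ _ ⟩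
    ∑< (suc s) (g ∘ suc)                    ≡⟨ recurrence-as-convolution s ⟩
    ∂ Vser (2 * suc s)                      ≡⟨ ℚₚ.+-identityʳ _ ⟨
    ∂ Vser (2 * suc s) -ℚ 0ℚ                ∎
    where
    g : ℕ → ℚ
    g a = Tser T (2 * a) *ℚ ∂ Vser (2 * (suc s ∸ a))

1-T : Series
1-T = oneS ⊕ (-ℚ 1ℚ) · Tser T

∂Vser⊛[1-T] : ∂ Vser ⊛ 1-T ≐ oneS
∂Vser⊛[1-T] n = begin
  (∂ Vser ⊛ 1-T) n                                   ≡⟨ ⊛-distribˡ-⊕ (∂ Vser) oneS ((-ℚ 1ℚ) · Tser T) n ⟩
  (∂ Vser ⊛ oneS) n +ℚ (∂ Vser ⊛ ((-ℚ 1ℚ) · Tser T)) n ≡⟨ cong₂ _+ℚ_ (⊛-identityʳ (∂ Vser) n) (⊛-·ʳ (-ℚ 1ℚ) (∂ Vser) (Tser T) n) ⟩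
  ∂ Vser n +ℚ -ℚ 1ℚ *ℚ (∂ Vser ⊛ Tser T) n            ≡⟨ cong (λ x → ∂ Vser n +ℚ -ℚ 1ℚ *ℚ x) (trans (⊛-comm (∂ Vser) (Tser T) n) (Tser⊛∂Vser n)) ⟩
  ∂ Vser n +ℚ -ℚ 1ℚ *ℚ (∂ Vser n -ℚ oneS n)           ≡⟨ solve 2 (λ d o → d :+ (:- con 1ℚ) :* (d :- o) := o) refl (∂ Vser n) (oneS n) ⟩
  oneS n                                             ∎
  where
  open ≡-Reasoning
  open ℚSolver.+-*-Solver

∂minusErfInvSq : ∂ minusErfInvSq ≐ (-ℚ 1ℚ) · (Vser ⊛ ∂ Vser)
∂minusErfInvSq n = begin
  ℕtoℚ (suc n) *ℚ -ℚ ((Vser ⊛ Vser) (suc n) *ℚ invℕ 2)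
    ≡⟨ solve 3 (λ a w i → a :* (:- (w :* i)) := :- (i :* (a :* w))) refl (ℕtoℚ (suc n)) ((Vser ⊛ Vser) (suc n)) (invℕ 2) ⟩
  -ℚ (invℕ 2 *ℚ ∂ (Vser ⊛ Vser) n)
    ≡⟨ cong (λ x → -ℚ (invℕ 2 *ℚ x)) (trans (∂-⊛ Vser Vser n) (cong (_+ℚ X) (⊛-comm (∂ Vser) Vser n))) ⟩
  -ℚ (invℕ 2 *ℚ (X +ℚ X))
    ≡⟨ solve 2 (λ i x → :- (i :* (x :+ x)) := (:- con 1ℚ) :* ((i :* (con 1ℚ :+ con 1ℚ)) :* x)) refl (invℕ 2) X ⟩
  -ℚ 1ℚ *ℚ ((invℕ 2 *ℚ (1ℚ +ℚ 1ℚ)) *ℚ X)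
    ≡⟨ cong (λ y → -ℚ 1ℚ *ℚ (y *ℚ X)) (trans (cong (invℕ 2 *ℚ_) (sym (ℕtoℚ-+ 1 1))) (invℕ-inverseˡ 2)) ⟩
  -ℚ 1ℚ *ℚ (1ℚ *ℚ X)
    ≡⟨ cong (-ℚ 1ℚ *ℚ_) (ℚₚ.*-identityˡ X) ⟩
  -ℚ 1ℚ *ℚ X ∎
  where
  open ≡-Reasoning
  open ℚSolver.+-*-Solver
  X = (Vser ⊛ ∂ Vser) n

∂[1-T] : ∂ 1-T ≐ ∂ minusErfInvSq ⊛ 1-T
∂[1-T] n = begin
  ℕtoℚ (suc n) *ℚ (0ℚ +ℚ -ℚ 1ℚ *ℚ Tser T (suc n))
    ≡⟨ solve 3 (λ a m t → a :* (con 0ℚ :+ m :* t) := m :* (a :* t)) refl (ℕtoℚ (suc n)) (-ℚ 1ℚ) (Tser T (suc n)) ⟩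
  -ℚ 1ℚ *ℚ ∂ (Tser T) n
    ≡⟨ cong (-ℚ 1ℚ *ℚ_) (∂Tser≐Vser n) ⟩
  -ℚ 1ℚ *ℚ Vser n
    ≡⟨ cong (-ℚ 1ℚ *ℚ_) (trans (⊛-congʳ Vser ∂Vser⊛[1-T] n) (⊛-identityʳ Vser n)) ⟨
  -ℚ 1ℚ *ℚ (Vser ⊛ (∂ Vser ⊛ 1-T)) n
    ≡⟨ cong (-ℚ 1ℚ *ℚ_) (⊛-assoc Vser (∂ Vser) 1-T n) ⟨
  -ℚ 1ℚ *ℚ ((Vser ⊛ ∂ Vser) ⊛ 1-T) n
    ≡⟨ ⊛-·ˡ (-ℚ 1ℚ) (Vser ⊛ ∂ Vser) 1-T n ⟨
  ((-ℚ 1ℚ · (Vser ⊛ ∂ Vser)) ⊛ 1-T) n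
    ≡⟨ ⊛-congˡ 1-T ∂minusErfInvSq n ⟨
  (∂ minusErfInvSq ⊛ 1-T) n ∎
  where
  open ≡-Reasoning
  open ℚSolver.+-*-Solver

expS-minusErfInvSq : expS minusErfInvSq ≐ 1-T
expS-minusErfInvSq = linear-ode-unique (∂ minusErfInvSq) (expS minusErfInvSq) 1-T refl (∂-expS minusErfInvSq refl) ∂[1-T]

Tser≐1-expS : ∀ n → Tser T n ≡ oneS n -ℚ expS minusErfInvSq n
Tser≐1-expS n = sym (trans (cong (λ x → oneS n -ℚ x) (expS-minusErfInvSq n))
  (solve 2 (λ o t → o :- (o :+ (:- con 1ℚ) :* t) := t) refl (oneS n) (Tser T n)))
  where open ℚSolver.+-*-Solver

theorem3p1 :
    Σ (ℕ → ℕ) λ T →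
      (∀ n → 1 ≤ n → CountIs (IsBIT n) (T n))
      × (∀ n → Tser T n ≡ oneS n -ℚ expS minusErfInvSq n)
      × (∀ n → Tser T n ≡ integS Vser n)
      × (∀ m → ℕtoℚ (T (suc m)) ≡ ((+ ((2 * m) !) /ℚ (2 ^ m)) {{m^n≢0 2 m}}) *ℚ c m)
      × (∀ n → 2 ≤ n → T n ≡ sum (map (λ k → ((2 * n ∸ 2) C (2 * k)) * T k * T (n ∸ k)) (applyUpTo suc (n ∸ 1))))
      × T 1 ≡ 1
theorem3p1 =
    T
  , (λ n _ → T-counts n)
  , Tser≐1-expS
  , Tser≐integS-Vser
  , (λ m → trans (T-closed-form m) (cong (_*ℚ c m) (sym (/-≡-*invℕ ((2 * m) !) (2 ^ m) {{m^n≢0 2 m}}))))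
  , T-recurrence
  , refl
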